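{- Let $G=(V,E)$ be a cycle (ring network) with edge costs $c:E\to\mathbb{R}_{\ge0}$, let $W\subseteq V$ be a set of terminals with $k=|W|$, and let $i\in W$. Then the PR instance $(G,c,W,i)$ has an optimal solution which is a tree solution.
   Context: Pyramidal Routing (PR) instance $(G,c,W,i)$ with source terminal $i\in W$: a solution is a set $\mathcal{P}_i$ of simple $i$-$j$-paths $P_{ij}$ in $G$, one for each $j\in W\setminus\{i\}$. For $e\in E$ let $n(e,\mathcal{P}_i)=|\{j\in W\setminus\{i\}: e\in P_{ij}\}|$ and $y(e,\mathcal{P}_i)=\min\{n(e,\mathcal{P}_i),k-n(e,\mathcal{P}_i)\}$. The cost of $\mathcal{P}_i$ is $\sum_{e\in E}c(e)\,y(e,\mathcal{P}_i)$; an optimal solution is one of minimum cost among all solutions. A tree solution is a solution whose paths together form a tree.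
   Formalization: The edge costs $c$ are nonnegative rationals rather than nonnegative reals. -}

module Defs where

open import Data.Nat using (ℕ; zero; suc; _+_; _∸_; _⊓_; _≡ᵇ_; _≤_)
open import Data.Bool using (Bool; true; false; _∧_; _∨_; if_then_else_)
open import Data.Fin using (Fin; toℕ)
open import Data.Fin.Subset using (Subset; _∈_; ∣_∣)
open import Data.Fin.Subset.Properties using (_∈?_)
open import Data.Fin.Properties using (_≟_)
open import Data.List using (List; []; _∷_; foldr; map)
open import Data.List.Relation.Unary.Any using (Any)
open import Data.List.Relation.Unary.Unique.Propositional using (Unique)
open import Data.List.Membership.Propositional using () renaming (_∈_ to _∈ₗ_)
open import Data.Product using (Σ; ∃; ∃-syntax; _×_; _,_; proj₁)
open import Data.Integer using (+_)
open import Data.Rational as ℚ using (ℚ; 0ℚ; _/_)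
open import Data.Unit using (⊤)
open import Data.Bool using (T)
open import Relation.Nullary using (yes; no; ¬_; Dec)
open import Relation.Binary.PropositionalEquality using (_≡_; _≢_)
open import Data.List using (allFin)

-- The cycle (ring network) C_n on vertex set Fin n.
-- Edges are indexed by Fin n: edge e joins vertex e and vertex e+1 (mod n).

nextℕ : ℕ → ℕ → ℕ
nextℕ n a = if suc a ≡ᵇ n then 0 else suc a

onEdge : (n : ℕ) → Fin n → Fin n → Fin n → Bool
onEdge n e x y =
  ((toℕ x ≡ᵇ toℕ e) ∧ (toℕ y ≡ᵇ nextℕ n (toℕ e))) ∨
  ((toℕ y ≡ᵇ toℕ e) ∧ (toℕ x ≡ᵇ nextℕ n (toℕ e)))

Joins : (n : ℕ) → Fin n → Fin n → Fin n → Set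
Joins n e x y = T (onEdge n e x y)

data Walk (n : ℕ) : Fin n → Fin n → Set where
  [_]   : (v : Fin n) → Walk n v v
  step  : (u : Fin n) {v w : Fin n} (e : Fin n) → Joins n e u v →
          Walk n v w → Walk n u w

verts : {n : ℕ} {u w : Fin n} → Walk n u w → List (Fin n)
verts [ v ] = v ∷ []
verts (step u e _ p) = u ∷ verts p

edges : {n : ℕ} {u w : Fin n} → Walk n u w → List (Fin n)
edges [ v ] = []
edges (step u e _ p) = e ∷ edges p

SimplePath : (n : ℕ) → Fin n → Fin n → Set
SimplePath n u w = Σ (Walk n u w) (λ p → Unique (verts p))

uses : {n : ℕ} {u w : Fin n} → Fin n → Walk n u w → Bool
uses e [ v ] = false
uses e (step u e' _ p) = (if toℕ e ≡ᵇ toℕ e' then true else false) ∨ uses e p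

Solution : (n : ℕ) → Subset n → Fin n → Set
Solution n W i = (j : Fin n) → j ∈ W → j ≢ i → SimplePath n i j

load : {n : ℕ} (W : Subset n) (i : Fin n) → Solution n W i → Fin n → ℕ
load {n} W i P e = foldr _+_ 0 (map ind (allFin n))
  where
  ind : Fin n → ℕ
  ind j with j ∈? W | j ≟ i
  ... | yes jW | no j≢i = if uses e (proj₁ (P j jW j≢i)) then 1 else 0
  ... | _      | _      = 0

yval : {n : ℕ} (W : Subset n) (i : Fin n) → Solution n W i → Fin n → ℕ
yval W i P e = load W i P e ⊓ (∣ W ∣ ∸ load W i P e)

ℕtoℚ : ℕ → ℚ
ℕtoℚ m = (+ m) / 1

cost : {n : ℕ} (c : Fin n → ℚ) (W : Subset n) (i : Fin n) → Solution n W i → ℚ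
cost {n} c W i P = foldr ℚ._+_ 0ℚ (map (λ e → c e ℚ.* ℕtoℚ (yval W i P e)) (allFin n))

Optimal : {n : ℕ} (c : Fin n → ℚ) (W : Subset n) (i : Fin n) → Solution n W i → Set
Optimal {n} c W i P = (Q : Solution n W i) → cost c W i P ℚ.≤ cost c W i Q

InH-vertex : {n : ℕ} (W : Subset n) (i : Fin n) → Solution n W i → Fin n → Set
InH-vertex {n} W i P v =
  (v ≡ i) ⊎' (∃[ j ] Σ (j ∈ W) λ jW → Σ (j ≢ i) λ j≢i → v ∈ₗ verts (proj₁ (P j jW j≢i)))
  where
  open import Data.Sum using () renaming (_⊎_ to _⊎'_)

InH-edge : {n : ℕ} (W : Subset n) (i : Fin n) → Solution n W i → Fin n → Set
InH-edge {n} W i P e =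
  ∃[ j ] Σ (j ∈ W) λ jW → Σ (j ≢ i) λ j≢i → e ∈ₗ edges (proj₁ (P j jW j≢i))

WalkInH : {n : ℕ} (W : Subset n) (i : Fin n) → Solution n W i →
          {u w : Fin n} → Walk n u w → Set
WalkInH W i P p = All (InH-edge W i P) (edges p)
  where open import Data.List.Relation.Unary.All using (All)

TreeSolution : {n : ℕ} (W : Subset n) (i : Fin n) → Solution n W i → Set
TreeSolution {n} W i P =
  (u v : Fin n) → InH-vertex W i P u → InH-vertex W i P v →
    (Σ (SimplePath n u v) λ p → WalkInH W i P (proj₁ p)) ×
    ((p q : SimplePath n u v) → WalkInH W i P (proj₁ p) → WalkInH W i P (proj₁ q) →
       verts (proj₁ p) ≡ verts (proj₁ q))

{-# OPTIONS --safe #-}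
-- Measure positions clockwise from i. A simple path from i to j on the cycle is the clockwise or the
-- anticlockwise arc, and cutting the edge c and routing every destination along the remaining line
-- gives a tree solution whose load on the edge p is ∣ A p - A c ∣, where A p counts the destinations
-- at positions 1 … p. Since the cost weights y x = min (x , k − x), the distance from x to 0 in ℤ/k,
-- it suffices to find for the loads f of any solution a cut c with y ∣ A p - A c ∣ ≤ y (f p) on every
-- edge: then the cheapest of the n tree solutions is optimal.
-- For edges p ≤ p' with D destinations between them the loads satisfy ∣ f p' - f p ∣ ≤ D ≤ f p + f p'
-- ≤ 2K − D, so y ∘ f is 1-Lipschitz in the positions, also when measured around the cycle. The two edges
-- at i carry K paths together; hence either their y-values add up to K, or a discrete intermediate
-- value argument finds a destination whose two edges have loads ⌊K/2⌋ and ⌊K/2⌋ + 1, whose y-values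
-- again add up to K. Choosing the cut so that the tree agrees with y ∘ f on that edge, the Lipschitz
-- bounds give the inequality everywhere.
module Submission where

module Routes where

  open import Data.Nat
  open import Data.Nat.Properties
  open import Data.Bool as Bool using (Bool; true; false; if_then_else_; not; f≤t; b≤b; T)
  open import Function.Bundles using (_⇔_; mk⇔)
  open import Relation.Binary.PropositionalEquality
  open import Relation.Nullary using (does; Dec; yes; no)
  open import Relation.Nullary.Decidable using (dec-true)
  open import Relation.Nullary.Reflects using (ofʸ; ofⁿ)
  open import Relation.Nullary.Negation using (contradiction)

  ⟦_⟧ : Bool → ℕ
  ⟦ b ⟧ = if b then 1 else 0

  ⟦does⟧-mono : ∀ {a b} {A : Set a} {B : Set b} (a? : Dec A) (b? : Dec B) → (A → B) → ⟦ does a? ⟧ ≤ ⟦ does b? ⟧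
  ⟦does⟧-mono (yes _) (yes _) _   = ≤-refl
  ⟦does⟧-mono (yes a) (no ¬b) a→b = contradiction (a→b a) ¬b
  ⟦does⟧-mono (no _)  _       _   = z≤n

  ≤ᵇ-monoʳ : ∀ q {p p'} → p ≤ p' → (q ≤ᵇ p) Bool.≤ (q ≤ᵇ p')
  ≤ᵇ-monoʳ q {p} {p'} p≤p' with q ≤ᵇ p | ≤ᵇ-reflects-≤ q p | q ≤ᵇ p' | ≤ᵇ-reflects-≤ q p'
  ... | true  | ofʸ q≤p | false | ofⁿ q≰p' = contradiction (≤-trans q≤p p≤p') q≰p'
  ... | true  | _       | true  | _        = b≤b
  ... | false | _       | true  | _        = f≤t
  ... | false | _       | false | _        = b≤b

  ≤ᵇ-true : ∀ {q p} → q ≤ p → (q ≤ᵇ p) ≡ true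
  ≤ᵇ-true {q} {p} q≤p with q ≤ᵇ p | ≤ᵇ-reflects-≤ q p
  ... | true  | _       = refl
  ... | false | ofⁿ q≰p = contradiction q≤p q≰p

  -- The route to a destination at position q uses the edge at position p when p < q if it runs clockwise,
  -- when q ≤ p otherwise; the argument reached is the bit q ≤ p. Entries with w = false count nothing.
  crossing : Bool → Bool → Bool
  crossing clockwise reached = if reached then not clockwise else clockwise

  crossesᵇ : Bool → Bool → ℕ
  crossesᵇ clockwise reached = ⟦ crossing clockwise reached ⟧

  crossing-clockwise : ∀ {q p} → T (crossing true (q ≤ᵇ p)) ⇔ p < q
  crossing-clockwise {q} {p} with q ≤ᵇ p | ≤ᵇ-reflects-≤ q p
  ... | true  | ofʸ q≤p = mk⇔ (λ ()) (λ p<q → contradiction q≤p (<⇒≱ p<q))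
  ... | false | ofⁿ q≰p = mk⇔ (λ _ → ≰⇒> q≰p) _

  crossing-anticlockwise : ∀ {q p} → T (crossing false (q ≤ᵇ p)) ⇔ q ≤ p
  crossing-anticlockwise {q} {p} with q ≤ᵇ p | ≤ᵇ-reflects-≤ q p
  ... | true  | ofʸ q≤p = mk⇔ (λ _ → q≤p) _
  ... | false | ofⁿ q≰p = mk⇔ (λ ()) (λ q≤p → contradiction q≤p q≰p)

  entersᵇ : Bool → Bool → ℕ
  entersᵇ reached reached' = if reached then 0 else ⟦ reached' ⟧

  passes : Bool → Bool → ℕ → ℕ → ℕ
  passes w b q p = if w then crossesᵇ b (q ≤ᵇ p) else 0

  below : Bool → ℕ → ℕ → ℕ
  below w q p = if w then ⟦ q ≤ᵇ p ⟧ else 0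

  enters : Bool → ℕ → ℕ → ℕ → ℕ
  enters w q p p' = if w then entersᵇ (q ≤ᵇ p) (q ≤ᵇ p') else 0

  private
    below-splitᵇ : ∀ {x x'} → x Bool.≤ x' → ⟦ x' ⟧ ≡ ⟦ x ⟧ + entersᵇ x x'
    below-splitᵇ f≤t = refl
    below-splitᵇ (b≤b {false}) = refl
    below-splitᵇ (b≤b {true}) = refl

    crosses-stepʳᵇ : ∀ b {x x'} → x Bool.≤ x' → crossesᵇ b x' ≤ crossesᵇ b x + entersᵇ x x'
    crosses-stepʳᵇ b     (b≤b {x}) = m≤m+n (crossesᵇ b x) (entersᵇ x x)
    crosses-stepʳᵇ false f≤t = ≤-refl
    crosses-stepʳᵇ true  f≤t = z≤n

    crosses-stepˡᵇ : ∀ b {x x'} → x Bool.≤ x' → crossesᵇ b x ≤ crossesᵇ b x' + entersᵇ x x'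
    crosses-stepˡᵇ b     (b≤b {x}) = m≤m+n (crossesᵇ b x) (entersᵇ x x)
    crosses-stepˡᵇ false f≤t = z≤n
    crosses-stepˡᵇ true  f≤t = ≤-refl

    enters≤crossesᵇ : ∀ b {x x'} → x Bool.≤ x' → entersᵇ x x' ≤ crossesᵇ b x + crossesᵇ b x'
    enters≤crossesᵇ b     (b≤b {false}) = z≤n
    enters≤crossesᵇ b     (b≤b {true})  = z≤n
    enters≤crossesᵇ false f≤t = ≤-refl
    enters≤crossesᵇ true  f≤t = s≤s z≤n

    crosses+enters≤2ᵇ : ∀ b {x x'} → x Bool.≤ x' → crossesᵇ b x + crossesᵇ b x' + entersᵇ x x' ≤ 2
    crosses+enters≤2ᵇ false (b≤b {false}) = z≤n
    crosses+enters≤2ᵇ false (b≤b {true})  = s≤s (s≤s z≤n)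
    crosses+enters≤2ᵇ true  (b≤b {false}) = s≤s (s≤s z≤n)
    crosses+enters≤2ᵇ true  (b≤b {true})  = z≤n
    crosses+enters≤2ᵇ false f≤t = s≤s (s≤s z≤n)
    crosses+enters≤2ᵇ true  f≤t = s≤s (s≤s z≤n)

    crosses-before-cutᵇ : ∀ {x x'} → x Bool.≤ x' → crossesᵇ x' x ≡ entersᵇ x x'
    crosses-before-cutᵇ f≤t = refl
    crosses-before-cutᵇ (b≤b {false}) = refl
    crosses-before-cutᵇ (b≤b {true}) = refl

    crosses-after-cutᵇ : ∀ {x x'} → x Bool.≤ x' → crossesᵇ x x' ≡ entersᵇ x x'
    crosses-after-cutᵇ f≤t = refl
    crosses-after-cutᵇ (b≤b {false}) = refl
    crosses-after-cutᵇ (b≤b {true}) = refl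

  below-split : ∀ w q {p p'} → p ≤ p' → below w q p' ≡ below w q p + enters w q p p'
  below-split false _ _ = refl
  below-split true  q p≤p' = below-splitᵇ (≤ᵇ-monoʳ q p≤p')

  passes-stepʳ : ∀ w b q {p p'} → p ≤ p' → passes w b q p' ≤ passes w b q p + enters w q p p'
  passes-stepʳ false _ _ _ = z≤n
  passes-stepʳ true  b q p≤p' = crosses-stepʳᵇ b (≤ᵇ-monoʳ q p≤p')

  passes-stepˡ : ∀ w b q {p p'} → p ≤ p' → passes w b q p ≤ passes w b q p' + enters w q p p'
  passes-stepˡ false _ _ _ = z≤n
  passes-stepˡ true  b q p≤p' = crosses-stepˡᵇ b (≤ᵇ-monoʳ q p≤p')

  enters≤passes+passes : ∀ w b q {p p'} → p ≤ p' → enters w q p p' ≤ passes w b q p + passes w b q p'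
  enters≤passes+passes false _ _ _ = z≤n
  enters≤passes+passes true  b q p≤p' = enters≤crossesᵇ b (≤ᵇ-monoʳ q p≤p')

  passes+passes+enters≤2 : ∀ w b q {p p'} → p ≤ p' → passes w b q p + passes w b q p' + enters w q p p' ≤ ⟦ w ⟧ + ⟦ w ⟧
  passes+passes+enters≤2 false _ _ _ = z≤n
  passes+passes+enters≤2 true  b q p≤p' = crosses+enters≤2ᵇ b (≤ᵇ-monoʳ q p≤p')

  passes-before-cut : ∀ w {c} q {p} → p ≤ c → passes w (q ≤ᵇ c) q p ≡ enters w q p c
  passes-before-cut false q p≤c = refl
  passes-before-cut true  q p≤c = crosses-before-cutᵇ (≤ᵇ-monoʳ q p≤c)

  passes-after-cut : ∀ w {c} q {p} → c ≤ p → passes w (q ≤ᵇ c) q p ≡ enters w q c p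
  passes-after-cut false q c≤p = refl
  passes-after-cut true  q c≤p = crosses-after-cutᵇ (≤ᵇ-monoʳ q c≤p)

  below-zero : ∀ w q → (w ≡ true → 1 ≤ q) → below w q 0 ≡ 0
  below-zero false q _ = refl
  below-zero true  q 1≤q with q | 1≤q refl
  ... | suc _ | _ = refl

  below-all : ∀ w {q N} → q ≤ N → below w q N ≡ ⟦ w ⟧
  below-all false _ = refl
  below-all true  q≤N rewrite ≤ᵇ-true q≤N = refl

  enters-step : ∀ w q p → enters w q p (suc p) ≤ ⟦ does (q ≟ suc p) ⟧
  enters-step false _ _ = z≤n
  enters-step true q p with q ≤ᵇ p | ≤ᵇ-reflects-≤ q p | q ≤ᵇ suc p | ≤ᵇ-reflects-≤ q (suc p)
  ... | true  | _       | _     | _         = z≤n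
  ... | false | _       | false | _         = z≤n
  ... | false | ofⁿ q≰p | true  | ofʸ q≤1+p =
    subst (λ q → 1 ≤ ⟦ does (q ≟ suc p) ⟧) (sym (≤-antisym q≤1+p (≰⇒> q≰p))) (≤-reflexive (cong ⟦_⟧ (sym (dec-true (suc p ≟ suc p) refl))))

module LineWalks where

  open import Data.Nat
  open import Data.Nat.Properties
  open import Data.List using (List; []; _∷_)
  open import Data.List.Membership.Propositional using (_∈_)
  open import Data.List.Relation.Unary.Any using (here; there)
  open import Data.List.Relation.Unary.All as All using ([])
  open import Data.List.Relation.Unary.AllPairs using ([]; _∷_; head; tail)
  open import Data.List.Relation.Unary.Unique.Propositional using (Unique)
  open import Data.Product using (_×_; _,_)
  open import Data.Sum using (_⊎_; inj₁; inj₂)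
  open import Relation.Binary.PropositionalEquality
  open import Relation.Nullary using (¬_; yes; no)
  open import Relation.Nullary.Negation using (contradiction)
  open import Function using (_∘_)

  -- Walks in the path graph on ℕ, in which the edge {a, a + 1} is named a.
  data LineWalk : ℕ → ℕ → Set where
    stop : (a : ℕ) → LineWalk a a
    up   : ∀ {a b} → LineWalk (suc a) b → LineWalk a b
    down : ∀ {a b} → LineWalk a b → LineWalk (suc a) b

  lineVertices : ∀ {a b} → LineWalk a b → List ℕ
  lineVertices (stop a)     = a ∷ []
  lineVertices (up {a} l)   = a ∷ lineVertices l
  lineVertices (down {a} l) = suc a ∷ lineVertices l

  lineEdges : ∀ {a b} → LineWalk a b → List ℕ
  lineEdges (stop a)     = []
  lineEdges (up {a} l)   = a ∷ lineEdges l
  lineEdges (down {a} l) = a ∷ lineEdges l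

  Between : ℕ → ℕ → ℕ → Set
  Between z a b = (a ≤ z × z ≤ b) ⊎ (b ≤ z × z ≤ a)

  EdgeBetween : ℕ → ℕ → ℕ → Set
  EdgeBetween z a b = (a ≤ z × z < b) ⊎ (b ≤ z × z < a)

  EdgeBetween-irrefl : ∀ {z a} → ¬ EdgeBetween z a a
  EdgeBetween-irrefl (inj₁ (a≤z , z<a)) = <⇒≱ z<a a≤z
  EdgeBetween-irrefl (inj₂ (a≤z , z<a)) = <⇒≱ z<a a≤z

  EdgeBetween-split : ∀ {z a b} c → EdgeBetween z a b → EdgeBetween z c a ⊎ EdgeBetween z c b
  EdgeBetween-split {z} c (inj₁ (a≤z , z<b)) with z <? c
  ... | yes z<c = inj₁ (inj₂ (a≤z , z<c))
  ... | no z≮c  = inj₂ (inj₁ (≮⇒≥ z≮c , z<b))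
  EdgeBetween-split {z} c (inj₂ (b≤z , z<a)) with z <? c
  ... | yes z<c = inj₂ (inj₂ (b≤z , z<c))
  ... | no z≮c  = inj₁ (inj₁ (≮⇒≥ z≮c , z<a))

  EdgeBetween-extend : ∀ {z a c d} → Between a c d → EdgeBetween z c a → EdgeBetween z c d
  EdgeBetween-extend (inj₁ (c≤a , a≤d)) (inj₁ (c≤z , z<a)) = inj₁ (c≤z , <-≤-trans z<a a≤d)
  EdgeBetween-extend (inj₁ (c≤a , a≤d)) (inj₂ (a≤z , z<c)) = contradiction (≤-trans c≤a a≤z) (<⇒≱ z<c)
  EdgeBetween-extend (inj₂ (d≤a , a≤c)) (inj₁ (c≤z , z<a)) = contradiction (≤-trans a≤c c≤z) (<⇒≱ z<a)
  EdgeBetween-extend (inj₂ (d≤a , a≤c)) (inj₂ (a≤z , z<c)) = inj₂ (≤-trans d≤a a≤z , z<c)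

  visits-between : ∀ {a b z} (l : LineWalk a b) → Between z a b → z ∈ lineVertices l
  visits-between (stop a) (inj₁ (a≤z , z≤a)) = here (≤-antisym z≤a a≤z)
  visits-between (stop a) (inj₂ (a≤z , z≤a)) = here (≤-antisym z≤a a≤z)
  visits-between {z = z} (up {a} l) btw with z ≟ a
  ... | yes z≡a = here z≡a
  ... | no z≢a with btw
  ...   | inj₁ (a≤z , z≤b) = there (visits-between l (inj₁ (≤∧≢⇒< a≤z (z≢a ∘ sym) , z≤b)))
  ...   | inj₂ (b≤z , z≤a) = there (visits-between l (inj₂ (b≤z , m≤n⇒m≤1+n z≤a)))
  visits-between {z = z} (down {a} l) btw with z ≟ suc a
  ... | yes z≡1+a = here z≡1+a
  ... | no z≢1+a with btw
  ...   | inj₁ (1+a≤z , z≤b) = there (visits-between l (inj₁ (<⇒≤ 1+a≤z , z≤b)))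
  ...   | inj₂ (b≤z , z≤1+a) = there (visits-between l (inj₂ (b≤z , ≤-pred (≤∧≢⇒< z≤1+a z≢1+a))))

  crosses-between : ∀ {a b z} (l : LineWalk a b) → EdgeBetween z a b → z ∈ lineEdges l
  crosses-between (stop a) e = contradiction e EdgeBetween-irrefl
  crosses-between {z = z} (up {a} l) e with z ≟ a
  ... | yes z≡a = here z≡a
  ... | no z≢a with e
  ...   | inj₁ (a≤z , z<b) = there (crosses-between l (inj₁ (≤∧≢⇒< a≤z (z≢a ∘ sym) , z<b)))
  ...   | inj₂ (b≤z , z<a) = there (crosses-between l (inj₂ (b≤z , m<n⇒m<1+n z<a)))
  crosses-between {z = z} (down {a} l) e with z ≟ a
  ... | yes z≡a = here z≡a
  ... | no z≢a with e
  ...   | inj₁ (1+a≤z , z<b) = there (crosses-between l (inj₁ (<⇒≤ 1+a≤z , z<b)))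
  ...   | inj₂ (b≤z , z<1+a) = there (crosses-between l (inj₂ (b≤z , ≤∧≢⇒< (≤-pred z<1+a) z≢a)))

  -- A simple walk on a line is monotone: its first step already points towards the end.
  up-simple⇒< : ∀ {a b} (l : LineWalk (suc a) b) → Unique (lineVertices (up l)) → a < b
  up-simple⇒< {a} l u = ≰⇒> λ b≤a → All.lookup (head u) (visits-between l (inj₂ (b≤a , n≤1+n a))) refl

  down-simple⇒≤ : ∀ {a b} (l : LineWalk a b) → Unique (lineVertices (down l)) → b ≤ a
  down-simple⇒≤ {a} l u = ≤-pred (≰⇒> λ 1+a≤b → All.lookup (head u) (visits-between l (inj₁ (n≤1+n a , 1+a≤b))) refl)

  simple-vertices⇒ : ∀ {a b z} (l : LineWalk a b) → Unique (lineVertices l) → z ∈ lineVertices l → Between z a b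
  simple-vertices⇒ (stop a) _ (here refl) = inj₁ (≤-refl , ≤-refl)
  simple-vertices⇒ (up l) u (here refl) = inj₁ (≤-refl , <⇒≤ (up-simple⇒< l u))
  simple-vertices⇒ (up l) u (there m) with simple-vertices⇒ l (tail u) m
  ... | inj₁ (1+a≤z , z≤b) = inj₁ (<⇒≤ 1+a≤z , z≤b)
  ... | inj₂ (b≤z , z≤1+a) = inj₁ (<⇒≤ (<-≤-trans (up-simple⇒< l u) b≤z) , ≤-trans z≤1+a (up-simple⇒< l u))
  simple-vertices⇒ (down l) u (here refl) = inj₂ (m≤n⇒m≤1+n (down-simple⇒≤ l u) , ≤-refl)
  simple-vertices⇒ (down l) u (there m) with simple-vertices⇒ l (tail u) m
  ... | inj₁ (a≤z , z≤b) = inj₂ (≤-trans (down-simple⇒≤ l u) a≤z , m≤n⇒m≤1+n (≤-trans z≤b (down-simple⇒≤ l u)))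
  ... | inj₂ (b≤z , z≤a) = inj₂ (b≤z , m≤n⇒m≤1+n z≤a)

  simple-edges⇒ : ∀ {a b z} (l : LineWalk a b) → Unique (lineVertices l) → z ∈ lineEdges l → EdgeBetween z a b
  simple-edges⇒ (up l) u (here refl) = inj₁ (≤-refl , up-simple⇒< l u)
  simple-edges⇒ (up l) u (there m) with simple-edges⇒ l (tail u) m
  ... | inj₁ (1+a≤z , z<b) = inj₁ (<⇒≤ 1+a≤z , z<b)
  ... | inj₂ (b≤z , z<1+a) = contradiction (<-≤-trans (up-simple⇒< l u) b≤z) (<⇒≱ z<1+a)
  simple-edges⇒ (down l) u (here refl) = inj₂ (down-simple⇒≤ l u , ≤-refl)
  simple-edges⇒ (down l) u (there m) with simple-edges⇒ l (tail u) m
  ... | inj₁ (a≤z , z<b) = contradiction (≤-trans (down-simple⇒≤ l u) a≤z) (<⇒≱ z<b)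
  ... | inj₂ (b≤z , z<a) = inj₂ (b≤z , m<n⇒m<1+n z<a)

  simple-walks-agree : ∀ {a b} (l l' : LineWalk a b) → Unique (lineVertices l) → Unique (lineVertices l') →
                       lineVertices l ≡ lineVertices l'
  simple-walks-agree (stop a) (stop .a) _ _ = refl
  simple-walks-agree (stop a) (up l') _ u' = contradiction (up-simple⇒< l' u') (<-irrefl refl)
  simple-walks-agree (stop _) (down l') _ u' = contradiction (down-simple⇒≤ l' u') (<-irrefl refl)
  simple-walks-agree (up l) (stop a) u _ = contradiction (up-simple⇒< l u) (<-irrefl refl)
  simple-walks-agree (down l) (stop _) u _ = contradiction (down-simple⇒≤ l u) (<-irrefl refl)
  simple-walks-agree (up {a} l) (up l') u u' = cong (a ∷_) (simple-walks-agree l l' (tail u) (tail u'))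
  simple-walks-agree (down {a} l) (down l') u u' = cong (suc a ∷_) (simple-walks-agree l l' (tail u) (tail u'))
  simple-walks-agree (up l) (down l') u u' = contradiction (up-simple⇒< l u) (<⇒≱ (s≤s (m≤n⇒m≤1+n (down-simple⇒≤ l' u'))))
  simple-walks-agree (down l) (up l') u u' = contradiction (up-simple⇒< l' u') (<⇒≱ (s≤s (m≤n⇒m≤1+n (down-simple⇒≤ l u))))

  ascend : ∀ {a b} → a ≤‴ b → LineWalk a b
  ascend ≤‴-refl      = stop _
  ascend (≤‴-step a<b) = up (ascend a<b)

  descend : ∀ {a b} → b ≤′ a → LineWalk a b
  descend ≤′-refl      = stop _
  descend (≤′-step b≤a) = down (descend b≤a)

  ascend-above : ∀ {a b z} (a≤b : a ≤‴ b) → z ∈ lineVertices (ascend a≤b) → a ≤ z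
  ascend-above ≤‴-refl (here refl) = ≤-refl
  ascend-above (≤‴-step a<b) (here refl) = ≤-refl
  ascend-above (≤‴-step a<b) (there m) = <⇒≤ (ascend-above a<b m)

  descend-below : ∀ {a b z} (b≤a : b ≤′ a) → z ∈ lineVertices (descend b≤a) → z ≤ a
  descend-below ≤′-refl (here refl) = ≤-refl
  descend-below (≤′-step b≤a) (here refl) = ≤-refl
  descend-below (≤′-step b≤a) (there m) = m≤n⇒m≤1+n (descend-below b≤a m)

  ascend-simple : ∀ {a b} (a≤b : a ≤‴ b) → Unique (lineVertices (ascend a≤b))
  ascend-simple ≤‴-refl = [] ∷ []
  ascend-simple (≤‴-step a<b) = All.tabulate (λ m a≡z → <-irrefl a≡z (ascend-above a<b m)) ∷ ascend-simple a<b

  descend-simple : ∀ {a b} (b≤a : b ≤′ a) → Unique (lineVertices (descend b≤a))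
  descend-simple ≤′-refl = [] ∷ []
  descend-simple (≤′-step b≤a) = All.tabulate (λ m 1+a≡z → <-irrefl (sym 1+a≡z) (s≤s (descend-below b≤a m))) ∷ descend-simple b≤a

  straight : ∀ a b → LineWalk a b
  straight a b with a ≤? b
  ... | yes a≤b = ascend (≤⇒≤‴ a≤b)
  ... | no a≰b  = descend (≤⇒≤′ (<⇒≤ (≰⇒> a≰b)))

  straight-simple : ∀ a b → Unique (lineVertices (straight a b))
  straight-simple a b with a ≤? b
  ... | yes a≤b = ascend-simple (≤⇒≤‴ a≤b)
  ... | no a≰b  = descend-simple (≤⇒≤′ (<⇒≤ (≰⇒> a≰b)))

  lineVertices-start : ∀ {a b} (l : LineWalk a b) → a ∈ lineVertices l
  lineVertices-start (stop a) = here refl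
  lineVertices-start (up l)   = here refl
  lineVertices-start (down l) = here refl

  castStart : ∀ {a a' b} → a ≡ a' → LineWalk a b → LineWalk a' b
  castStart refl l = l

  lineVertices-castStart : ∀ {a a' b} (eq : a ≡ a') (l : LineWalk a b) → lineVertices (castStart eq l) ≡ lineVertices l
  lineVertices-castStart refl l = refl

  lineEdges-castStart : ∀ {a a' b} (eq : a ≡ a') (l : LineWalk a b) → lineEdges (castStart eq l) ≡ lineEdges l
  lineEdges-castStart refl l = refl

module LoadProfiles where

  open import Data.Nat
  open import Data.Nat.Properties
  open import Data.Nat.Tactic.RingSolver using (solve-∀)
  open import Algebra.Properties.CommutativeSemigroup +-commutativeSemigroup
  open import Data.Product using (Σ; _×_; _,_)
  open import Data.Sum using (_⊎_; inj₁; inj₂)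
  open import Relation.Binary.PropositionalEquality
  open import Relation.Nullary using (yes; no)
  open import Relation.Nullary.Negation using (contradiction)

  y : ℕ → ℕ → ℕ
  y k x = x ⊓ (k ∸ x)

  module _ {k : ℕ} where

    y≤ : ∀ x → y k x ≤ x
    y≤ x = m⊓n≤m x (k ∸ x)

    y≤k∸ : ∀ x → y k x ≤ k ∸ x
    y≤k∸ x = m⊓n≤n x (k ∸ x)

    y-far : ∀ {x U} → k ≤ U + x → y k x ≤ U
    y-far {x} {U} k≤U+x = ≤-trans (y≤k∸ x) (m≤n+o⇒m∸n≤o k x (subst (k ≤_) (+-comm U x) k≤U+x))

    y-near : ∀ {a t U} → a ≤ t + U → t ≤ a + U → y k ∣ a - t ∣ ≤ U
    y-near {a} {t} {U} a≤t+U t≤a+U = ≤-trans (y≤ ∣ a - t ∣) ∣a-t∣≤U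
      where
      ∣a-t∣≤U : ∣ a - t ∣ ≤ U
      ∣a-t∣≤U with ≤-total a t
      ... | inj₁ a≤t rewrite m≤n⇒∣m-n∣≡n∸m a≤t = m≤n+o⇒m∸n≤o t a t≤a+U
      ... | inj₂ t≤a rewrite m≤n⇒∣n-m∣≡n∸m t≤a = m≤n+o⇒m∸n≤o a t a≤t+U

    y-wrap : ∀ {a t U} → t ≤ a → k + t ≤ U + a → y k ∣ a - t ∣ ≤ U
    y-wrap {a} {t} {U} t≤a k+t≤U+a rewrite m≤n⇒∣n-m∣≡n∸m t≤a = y-far (+-cancelʳ-≤ t k (U + (a ∸ t)) (begin
      k + t               ≤⟨ k+t≤U+a ⟩
      U + a               ≡⟨ cong (U +_) (sym (m∸n+n≡m t≤a)) ⟩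
      U + ((a ∸ t) + t)   ≡⟨ sym (+-assoc U (a ∸ t) t) ⟩
      U + (a ∸ t) + t     ∎))
      where open ≤-Reasoning

    y-lipschitz : ∀ {x z D} → x ≤ z + D → z ≤ x + D → z ≤ k → y k x ≤ y k z + D
    y-lipschitz {x} {z} {D} x≤z+D z≤x+D z≤k with ⊓-sel z (k ∸ z)
    ... | inj₁ yz≡z rewrite yz≡z = ≤-trans (y≤ x) x≤z+D
    ... | inj₂ yz≡k∸z rewrite yz≡k∸z = ≤-trans (y≤k∸ x) (m≤n+o⇒m∸n≤o k x (begin
      k                   ≡⟨ sym (m∸n+n≡m z≤k) ⟩
      (k ∸ z) + z         ≤⟨ +-monoʳ-≤ (k ∸ z) z≤x+D ⟩
      (k ∸ z) + (x + D)   ≡⟨ x∙yz≈y∙xz (k ∸ z) x D ⟩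
      x + ((k ∸ z) + D)   ∎))
      where open ≤-Reasoning

    -- Here x lies within k ∸ D of − z in ℤ/k, and y k (k ∸ z) = y k z.
    y-opposite : ∀ {x z D} → D ≤ x + z → x + z + D ≤ k + k → x ≤ k → z ≤ k → y k x + D ≤ y k z + k
    y-opposite {x} {z} {D} D≤x+z x+z+D≤2k x≤k z≤k with ⊓-sel z (k ∸ z)
    ... | inj₁ yz≡z rewrite yz≡z = begin
      y k x + D           ≤⟨ +-mono-≤ (y≤k∸ x) D≤x+z ⟩
      (k ∸ x) + (x + z)   ≡⟨ sym (+-assoc (k ∸ x) x z) ⟩
      (k ∸ x) + x + z     ≡⟨ cong (_+ z) (m∸n+n≡m x≤k) ⟩
      k + z               ≡⟨ +-comm k z ⟩
      z + k               ∎
      where open ≤-Reasoning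
    ... | inj₂ yz≡k∸z rewrite yz≡k∸z = +-cancelʳ-≤ z (y k x + D) ((k ∸ z) + k) (begin
      y k x + D + z       ≤⟨ +-monoˡ-≤ z (+-monoˡ-≤ D (y≤ x)) ⟩
      x + D + z           ≡⟨ xy∙z≈xz∙y x D z ⟩
      x + z + D           ≤⟨ x+z+D≤2k ⟩
      k + k               ≡⟨ cong (_+ k) (sym (m∸n+n≡m z≤k)) ⟩
      (k ∸ z) + z + k     ≡⟨ xy∙z≈xz∙y (k ∸ z) z k ⟩
      (k ∸ z) + k + z     ∎)
      where open ≤-Reasoning

  -- For a routing to K destinations with load f p on the edge p, where A p counts the destinations
  -- at positions ≤ p: each of the gap destinations between the edges p and p' is routed through exactly
  -- one of them, every other destination through both or neither.
  record Consistent (K : ℕ) (A f : ℕ → ℕ) (p p' : ℕ) : Set where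
    field
      gap        : ℕ
      A-gap      : A p' ≡ A p + gap
      f-stepʳ    : f p' ≤ f p + gap
      f-stepˡ    : f p ≤ f p' + gap
      gap≤f+f    : gap ≤ f p + f p'
      f+f+gap≤2K : f p + f p' + gap ≤ K + K

  crossing-up : ∀ (g : ℕ → ℕ) {x} N → g 0 ≤ x → x < g N → Σ ℕ λ p → p < N × g p ≤ x × x < g (suc p)
  crossing-up g zero g0≤x x<g0 = contradiction g0≤x (<⇒≱ x<g0)
  crossing-up g {x} (suc N) g0≤x x<gN+1 with g N ≤? x
  ... | yes gN≤x = N , ≤-refl , gN≤x , x<gN+1
  ... | no gN≰x with crossing-up g N g0≤x (≰⇒> gN≰x)
  ...   | p , p<N , crossing = p , m<n⇒m<1+n p<N , crossing

  crossing-down : ∀ (g : ℕ → ℕ) {x} N → x < g 0 → g N ≤ x → Σ ℕ λ p → p < N × x < g p × g (suc p) ≤ x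
  crossing-down g zero x<g0 g0≤x = contradiction g0≤x (<⇒≱ x<g0)
  crossing-down g {x} (suc N) x<g0 gN+1≤x with g N ≤? x
  ... | no gN≰x = N , ≤-refl , ≰⇒> gN≰x , gN+1≤x
  ... | yes gN≤x with crossing-down g N x<g0 gN≤x
  ...   | p , p<N , crossing = p , m<n⇒m<1+n p<N , crossing

  straddle : ∀ {x x' m g} → x ≤ m → m < x' → x' ≤ x + g → g ≤ 1 → x ≡ m × x' ≡ suc m × g ≡ 1
  straddle {x} {x'} {m} {zero} x≤m m<x' x'≤x+g _ = contradiction (≤-trans x'≤x+g (≤-trans (≤-reflexive (+-identityʳ x)) x≤m)) (<⇒≱ m<x')
  straddle {x} {x'} {m} {suc zero} x≤m m<x' x'≤x+g _ = ≤-antisym x≤m (≤-pred m+1≤x+1) , ≤-antisym (≤-trans x'≤x+g (≤-trans (≤-reflexive (+-comm x 1)) (s≤s x≤m))) m<x' , refl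
    where
    m+1≤x+1 : suc m ≤ suc x
    m+1≤x+1 = ≤-trans m<x' (≤-trans x'≤x+g (≤-reflexive (+-comm x 1)))
  straddle {g = suc (suc _)} _ _ _ (s≤s ())

  m+m≤n+n⇒m≤n : ∀ {m n} → m + m ≤ n + n → m ≤ n
  m+m≤n+n⇒m≤n {m} {n} m+m≤n+n with m ≤? n
  ... | yes m≤n = m≤n
  ... | no m≰n = contradiction m+m≤n+n (<⇒≱ (+-mono-< (≰⇒> m≰n) (≰⇒> m≰n)))

  module Profile (K n₀ : ℕ) (A f : ℕ → ℕ)
                 (A-zero : A 0 ≡ 0) (A-end : A n₀ ≡ K) (A-step : ∀ p → A (suc p) ≤ suc (A p))
                 (consistent : ∀ {p p'} → p ≤ p' → Consistent K A f p p') where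

    k : ℕ
    k = suc K

    yf : ℕ → ℕ
    yf p = y k (f p)

    gap : ∀ {p p'} → p ≤ p' → ℕ
    gap p≤p' = Consistent.gap (consistent p≤p')

    A-gap : ∀ {p p'} (p≤p' : p ≤ p') → A p' ≡ A p + gap p≤p'
    A-gap p≤p' = Consistent.A-gap (consistent p≤p')

    f≤K : ∀ p → f p ≤ K
    f≤K p = m+m≤n+n⇒m≤n (m+n≤o⇒m≤o (f p + f p) (Consistent.f+f+gap≤2K (consistent (≤-refl {p}))))

    f≤k : ∀ p → f p ≤ k
    f≤k p = m≤n⇒m≤1+n (f≤K p)

    yf≤K : ∀ p → yf p ≤ K
    yf≤K p = ≤-trans (y≤ (f p)) (f≤K p)

    A≤K : ∀ {p} → p ≤ n₀ → A p ≤ K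
    A≤K p≤n₀ = subst (_ ≤_) (trans (sym (A-gap p≤n₀)) A-end) (m≤m+n _ _)

    yf-stepˡ : ∀ {p p'} (p≤p' : p ≤ p') → yf p ≤ yf p' + gap p≤p'
    yf-stepˡ {p} {p'} p≤p' = y-lipschitz f-stepˡ f-stepʳ (f≤k p')
      where open Consistent (consistent p≤p') hiding (gap)

    yf-stepʳ : ∀ {p p'} (p≤p' : p ≤ p') → yf p' ≤ yf p + gap p≤p'
    yf-stepʳ {p} {p'} p≤p' = y-lipschitz f-stepʳ f-stepˡ (f≤k p)
      where open Consistent (consistent p≤p') hiding (gap)

    2K≤2k : K + K ≤ k + k
    2K≤2k = +-mono-≤ (n≤1+n K) (n≤1+n K)

    yf-oppositeˡ : ∀ {p p'} (p≤p' : p ≤ p') → yf p + gap p≤p' ≤ yf p' + k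
    yf-oppositeˡ {p} {p'} p≤p' = y-opposite gap≤f+f (≤-trans f+f+gap≤2K 2K≤2k) (f≤k p) (f≤k p')
      where open Consistent (consistent p≤p') hiding (gap)

    yf-oppositeʳ : ∀ {p p'} (p≤p' : p ≤ p') → yf p' + gap p≤p' ≤ yf p + k
    yf-oppositeʳ {p} {p'} p≤p' =
      y-opposite (≤-trans gap≤f+f (≤-reflexive (+-comm (f p) (f p'))))
                 (≤-trans (≤-reflexive (cong (_+ gap p≤p') (+-comm (f p') (f p)))) (≤-trans f+f+gap≤2K 2K≤2k))
                 (f≤k p') (f≤k p)
      where open Consistent (consistent p≤p') hiding (gap)

    Dominating : ℕ → Set
    Dominating t = ∀ p → p ≤ n₀ → y k ∣ A p - t ∣ ≤ yf p

    A-onto : ∀ {t} → t ≤ K → Σ ℕ λ c → c ≤ n₀ × A c ≡ t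
    A-onto {zero} _ = 0 , z≤n , A-zero
    A-onto {suc t} t<K with crossing-up A n₀ (≤-trans (≤-reflexive A-zero) z≤n) (subst (t <_) (sym A-end) t<K)
    ... | p , p<n₀ , Ap≤t , t<Ap+1 = suc p , p<n₀ , ≤-antisym (≤-trans (A-step p) (s≤s Ap≤t)) t<Ap+1

    DominatingCut : Set
    DominatingCut = Σ ℕ λ c → c ≤ n₀ × Dominating (A c)

    cut-at : ∀ {t} → t ≤ K → Dominating t → DominatingCut
    cut-at t≤K dom with A-onto t≤K
    ... | c , c≤n₀ , refl = c , c≤n₀ , dom

    Balanced : ℕ → ℕ → Set
    Balanced p p' = K ≤ yf p + yf p'

    f-source : f 0 + f n₀ ≡ K
    f-source = ≤-antisym (+-cancelʳ-≤ K (f 0 + f n₀) K (subst (λ g → f 0 + f n₀ + g ≤ K + K) gap≡K f+f+gap≤2K))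
                         (subst (_≤ f 0 + f n₀) gap≡K gap≤f+f)
      where
      open Consistent (consistent (z≤n {n₀})) using (gap≤f+f; f+f+gap≤2K)
      gap≡K : gap (z≤n {n₀}) ≡ K
      gap≡K = trans (sym (cong (_+ _) A-zero)) (trans (sym (A-gap z≤n)) A-end)

    -- In both constructions below t is chosen so that the tree's y-value on the balanced edge equals the
    -- solution's, and the Lipschitz bounds carry the comparison to every other edge.
    balanced-at-source : Balanced n₀ 0 → Σ ℕ λ t → t ≤ K × Dominating t
    balanced-at-source K≤u+v = t , m∸n≤m K u , dominating
      where
      u v t : ℕ
      u = yf n₀
      v = yf 0
      t = K ∸ u
      t+u≡K : t + u ≡ K
      t+u≡K = m∸n+n≡m (yf≤K n₀)
      dominating : Dominating t
      dominating p p≤n₀ = y-near a≤t+U t≤a+U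
        where
        U a : ℕ
        U = yf p
        a = A p
        a≡g₁ : a ≡ gap (z≤n {p})
        a≡g₁ = trans (A-gap z≤n) (cong (_+ _) A-zero)
        a+g₂≡K : a + gap p≤n₀ ≡ K
        a+g₂≡K = trans (sym (A-gap p≤n₀)) A-end
        a≤t+U : a ≤ t + U
        a≤t+U = +-cancelʳ-≤ u a (t + U) (begin
          a + u                ≤⟨ +-monoʳ-≤ a (yf-stepʳ p≤n₀) ⟩
          a + (U + gap p≤n₀)   ≡⟨ x∙yz≈y∙xz a U _ ⟩
          U + (a + gap p≤n₀)   ≡⟨ cong (U +_) (trans a+g₂≡K (sym t+u≡K)) ⟩
          U + (t + u)          ≡⟨ x∙yz≈xy∙z U t u ⟩
          U + t + u            ≡⟨ cong (_+ u) (+-comm U t) ⟩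
          t + U + u            ∎)
          where open ≤-Reasoning
        t≤a+U : t ≤ a + U
        t≤a+U = +-cancelʳ-≤ u t (a + U) (begin
          t + u                ≡⟨ t+u≡K ⟩
          K                    ≤⟨ K≤u+v ⟩
          u + v                ≤⟨ +-monoʳ-≤ u (yf-stepˡ (z≤n {p})) ⟩
          u + (U + gap z≤n)    ≡⟨ cong (λ g → u + (U + g)) (sym a≡g₁) ⟩
          u + (U + a)          ≡⟨ x∙yz≈zy∙x u U a ⟩
          a + U + u            ∎)
          where open ≤-Reasoning

    module Crossing (P : ℕ) (P<n₀ : P < n₀) (A-jump : A (suc P) ≡ suc (A P)) (balanced : Balanced P (suc P)) where

      R u v : ℕ
      R = A P
      u = yf P
      v = yf (suc P)

      after-jump : ∀ {p} (q : suc P ≤ p) → A p ≡ suc R + gap q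
      after-jump q = trans (A-gap q) (cong (_+ _) A-jump)

      before-jump : ∀ {p} (q : p ≤ P) (q' : p ≤ suc P) → gap q' ≡ suc (gap q)
      before-jump {p} q q' = +-cancelˡ-≡ (A p) _ _ (begin
        A p + gap q'         ≡⟨ sym (A-gap q') ⟩
        A (suc P)            ≡⟨ A-jump ⟩
        suc (A P)            ≡⟨ cong suc (A-gap q) ⟩
        suc (A p + gap q)    ≡⟨ sym (+-suc (A p) (gap q)) ⟩
        A p + suc (gap q)    ∎)
        where open ≡-Reasoning

      module CutBefore (u≤R : u ≤ R) where

        t : ℕ
        t = R ∸ u

        t+u≡R : t + u ≡ R
        t+u≡R = m∸n+n≡m u≤R

        dominating-after : ∀ {p} → suc P ≤ p → y k ∣ A p - t ∣ ≤ yf p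
        dominating-after {p} q = y-wrap t≤a k+t≤U+a
          where
          U : ℕ
          U = yf p
          t≤a : t ≤ A p
          t≤a = ≤-trans (m∸n≤m R u) (≤-trans (n≤1+n R) (subst (suc R ≤_) (sym (after-jump q)) (m≤m+n (suc R) _)))
          k+t≤U+a : k + t ≤ U + A p
          k+t≤U+a = begin
            suc K + t                   ≤⟨ +-monoˡ-≤ t (s≤s (≤-trans balanced (+-monoʳ-≤ u (yf-stepˡ q)))) ⟩
            suc (u + (U + gap q)) + t   ≡⟨ rearrange u U (gap q) t ⟩
            U + (suc (t + u) + gap q)   ≡⟨ cong (λ r → U + (suc r + gap q)) t+u≡R ⟩
            U + (suc R + gap q)         ≡⟨ cong (U +_) (sym (after-jump q)) ⟩
            U + A p                     ∎
            where
            open ≤-Reasoning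
            rearrange : ∀ u U g t → suc (u + (U + g)) + t ≡ U + (suc (t + u) + g)
            rearrange = solve-∀

        dominating-before : ∀ {p} → p ≤ P → y k ∣ A p - t ∣ ≤ yf p
        dominating-before {p} q = y-near a≤t+U t≤a+U
          where
          U a : ℕ
          U = yf p
          a = A p
          q' : p ≤ suc P
          q' = m≤n⇒m≤1+n q
          R≡a+g : R ≡ a + gap q
          R≡a+g = A-gap q
          a≤t+U : a ≤ t + U
          a≤t+U = +-cancelʳ-≤ u a (t + U) (begin
            a + u               ≤⟨ +-monoʳ-≤ a (yf-stepʳ q) ⟩
            a + (U + gap q)     ≡⟨ x∙yz≈y∙xz a U (gap q) ⟩
            U + (a + gap q)     ≡⟨ cong (U +_) (trans (sym R≡a+g) (sym t+u≡R)) ⟩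
            U + (t + u)         ≡⟨ sym (+-assoc U t u) ⟩
            U + t + u           ≡⟨ cong (_+ u) (+-comm U t) ⟩
            t + U + u           ∎)
            where open ≤-Reasoning
          v+g≤U+K : v + gap q ≤ U + K
          v+g≤U+K = ≤-pred (subst₂ _≤_ (+-suc v (gap q)) (+-suc U K)
                      (subst (λ g → v + g ≤ U + k) (before-jump q q') (yf-oppositeʳ q')))
          g≤u+U : gap q ≤ u + U
          g≤u+U = +-cancelʳ-≤ K (gap q) (u + U) (begin
            gap q + K           ≤⟨ +-monoʳ-≤ (gap q) balanced ⟩
            gap q + (u + v)     ≡⟨ x∙yz≈y∙zx (gap q) u v ⟩
            u + (v + gap q)     ≤⟨ +-monoʳ-≤ u v+g≤U+K ⟩
            u + (U + K)         ≡⟨ sym (+-assoc u U K) ⟩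
            u + U + K           ∎)
            where open ≤-Reasoning
          t≤a+U : t ≤ a + U
          t≤a+U = +-cancelʳ-≤ u t (a + U) (begin
            t + u               ≡⟨ trans t+u≡R R≡a+g ⟩
            a + gap q           ≤⟨ +-monoʳ-≤ a g≤u+U ⟩
            a + (u + U)         ≡⟨ x∙yz≈xz∙y a u U ⟩
            a + U + u           ∎)
            where open ≤-Reasoning

        dominating : Dominating t
        dominating p _ with suc P ≤? p
        ... | yes P<p  = dominating-after P<p
        ... | no P≮p   = dominating-before (≤-pred (≰⇒> P≮p))

      module CutAfter (R<u : R < u) where

        e t : ℕ
        e = u ∸ suc R
        t = K ∸ e

        R+1+e≡u : suc R + e ≡ u
        R+1+e≡u = m+[n∸m]≡n R<u

        t+e≡K : t + e ≡ K
        t+e≡K = m∸n+n≡m (≤-trans (m∸n≤m u (suc R)) (yf≤K P))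

        R<t : R < t
        R<t = +-cancelʳ-≤ e (suc R) t (begin
          suc R + e    ≡⟨ R+1+e≡u ⟩
          u            ≤⟨ yf≤K P ⟩
          K            ≡⟨ sym t+e≡K ⟩
          t + e        ∎)
          where open ≤-Reasoning

        dominating-after : ∀ {p} → suc P ≤ p → y k ∣ A p - t ∣ ≤ yf p
        dominating-after {p} q = y-near a≤t+U t≤a+U
          where
          U a : ℕ
          U = yf p
          a = A p
          q' : P ≤ p
          q' = <⇒≤ q
          t≤a+U : t ≤ a + U
          t≤a+U = +-cancelʳ-≤ e t (a + U) (begin
            t + e                         ≡⟨ t+e≡K ⟩
            K                             ≤⟨ balanced ⟩
            u + v                         ≤⟨ +-monoʳ-≤ u (yf-stepˡ q) ⟩
            u + (U + gap q)               ≡⟨ cong (_+ (U + gap q)) (sym R+1+e≡u) ⟩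
            suc R + e + (U + gap q)       ≡⟨ rearrange (suc R) e U (gap q) ⟩
            suc R + gap q + U + e         ≡⟨ cong (λ a → a + U + e) (sym (after-jump q)) ⟩
            a + U + e                     ∎)
            where
            open ≤-Reasoning
            rearrange : ∀ r e U g → r + e + (U + g) ≡ r + g + U + e
            rearrange = solve-∀
          a≤t+U : a ≤ t + U
          a≤t+U = +-cancelʳ-≤ (suc e) a (t + U) (≤-pred (begin
            suc (a + suc e)               ≡⟨ cong (λ a → suc (a + suc e)) (A-gap q') ⟩
            suc (R + gap q' + suc e)      ≡⟨ rearrange R (gap q') e ⟩
            suc (suc R + e + gap q')      ≡⟨ cong (λ w → suc (w + gap q')) R+1+e≡u ⟩
            suc (u + gap q')              ≤⟨ s≤s (yf-oppositeˡ q') ⟩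
            suc (U + suc K)               ≡⟨ cong (λ K → suc (U + suc K)) (sym t+e≡K) ⟩
            suc (U + suc (t + e))         ≡⟨ cong suc (rearrange′ U t e) ⟩
            suc (t + U + suc e)           ∎))
            where
            open ≤-Reasoning
            rearrange : ∀ R g e → suc (R + g + suc e) ≡ suc (suc R + e + g)
            rearrange = solve-∀
            rearrange′ : ∀ U t e → U + suc (t + e) ≡ t + U + suc e
            rearrange′ = solve-∀

        dominating-before : ∀ {p} → p ≤ P → y k ∣ A p - t ∣ ≤ yf p
        dominating-before {p} q = subst (_≤ U) (cong (y k) (∣-∣-comm t a)) (y-wrap a≤t k+a≤U+t)
          where
          U a : ℕ
          U = yf p
          a = A p
          a≤t : a ≤ t
          a≤t = ≤-trans (subst (a ≤_) (sym (A-gap q)) (m≤m+n a _)) (<⇒≤ R<t)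
          a+1+e≤U : suc a + e ≤ U
          a+1+e≤U = +-cancelʳ-≤ (gap q) (suc a + e) U (begin
            suc a + e + gap q             ≡⟨ rearrange a e (gap q) ⟩
            suc (a + gap q) + e           ≡⟨ cong (λ r → suc r + e) (sym (A-gap q)) ⟩
            suc R + e                     ≡⟨ R+1+e≡u ⟩
            u                             ≤⟨ yf-stepʳ q ⟩
            U + gap q                     ∎)
            where
            open ≤-Reasoning
            rearrange : ∀ a e g → suc a + e + g ≡ suc (a + g) + e
            rearrange = solve-∀
          k+a≤U+t : k + a ≤ U + t
          k+a≤U+t = begin
            suc K + a                     ≡⟨ cong (λ K → suc K + a) (sym t+e≡K) ⟩
            suc (t + e) + a               ≡⟨ rearrange t e a ⟩
            suc a + e + t                 ≤⟨ +-monoˡ-≤ t a+1+e≤U ⟩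
            U + t                         ∎
            where
            open ≤-Reasoning
            rearrange : ∀ t e a → suc (t + e) + a ≡ suc a + e + t
            rearrange = solve-∀

        dominating : Dominating t
        dominating p _ with suc P ≤? p
        ... | yes P<p  = dominating-after P<p
        ... | no P≮p   = dominating-before (≤-pred (≰⇒> P≮p))

      dominating-near-crossing : Σ ℕ λ t → t ≤ K × Dominating t
      dominating-near-crossing with u ≤? R
      ... | yes u≤R = CutBefore.t u≤R , ≤-trans (m∸n≤m R u) (A≤K (<⇒≤ P<n₀)) , CutBefore.dominating u≤R
      ... | no u≰R  = CutAfter.t (≰⇒> u≰R) , m∸n≤m K (CutAfter.e (≰⇒> u≰R)) , CutAfter.dominating (≰⇒> u≰R)

    gap≤1 : ∀ P → gap (n≤1+n P) ≤ 1
    gap≤1 P = +-cancelˡ-≤ (A P) (gap (n≤1+n P)) 1 (begin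
      A P + gap (n≤1+n P)   ≡⟨ sym (A-gap (n≤1+n P)) ⟩
      A (suc P)             ≤⟨ A-step P ⟩
      suc (A P)             ≡⟨ +-comm 1 (A P) ⟩
      A P + 1               ∎)
      where open ≤-Reasoning

    x₀ : ℕ
    x₀ = ⌊ K /2⌋

    x₀+⌈K/2⌉≡K : x₀ + ⌈ K /2⌉ ≡ K
    x₀+⌈K/2⌉≡K = ⌊n/2⌋+⌈n/2⌉≡n K

    ⌈K/2⌉≤1+x₀ : ⌈ K /2⌉ ≤ suc x₀
    ⌈K/2⌉≤1+x₀ = ⌊n/2⌋-mono (n≤1+n (suc K))

    y-small : ∀ {x} → x ≤ x₀ → y k x ≡ x
    y-small {x} x≤x₀ = m≤n⇒m⊓n≡m (m+n≤o⇒m≤o∸n x (begin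
      x + x          ≤⟨ +-mono-≤ x≤x₀ (≤-trans x≤x₀ (⌊n/2⌋≤⌈n/2⌉ K)) ⟩
      x₀ + ⌈ K /2⌉   ≡⟨ x₀+⌈K/2⌉≡K ⟩
      K              ≤⟨ n≤1+n K ⟩
      k              ∎))
      where open ≤-Reasoning

    balanced-halves : K ≤ y k x₀ + y k (suc x₀)
    balanced-halves = begin
      K                          ≡⟨ sym x₀+⌈K/2⌉≡K ⟩
      x₀ + ⌈ K /2⌉               ≤⟨ +-mono-≤ (≤-reflexive (sym (y-small ≤-refl))) (⊓-glb ⌈K/2⌉≤1+x₀ ⌈K/2⌉≤k∸[1+x₀]) ⟩
      y k x₀ + y k (suc x₀)      ∎
      where
      open ≤-Reasoning
      ⌈K/2⌉≤k∸[1+x₀] : ⌈ K /2⌉ ≤ k ∸ suc x₀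
      ⌈K/2⌉≤k∸[1+x₀] = ≤-reflexive (sym (trans (cong (_∸ x₀) (sym x₀+⌈K/2⌉≡K)) (m+n∸m≡n x₀ ⌈ K /2⌉)))

    balanced-at-halves : ∀ P → (f P ≡ x₀ × f (suc P) ≡ suc x₀) ⊎ (f P ≡ suc x₀ × f (suc P) ≡ x₀) → Balanced P (suc P)
    balanced-at-halves P (inj₁ (fP≡x₀ , fP+1≡1+x₀)) rewrite fP≡x₀ | fP+1≡1+x₀ = balanced-halves
    balanced-at-halves P (inj₂ (fP≡1+x₀ , fP+1≡x₀)) rewrite fP≡1+x₀ | fP+1≡x₀ =
      subst (K ≤_) (+-comm (y k x₀) (y k (suc x₀))) balanced-halves

    cut-at-crossing : ∀ P → P < n₀ → gap (n≤1+n P) ≡ 1 →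
                      (f P ≡ x₀ × f (suc P) ≡ suc x₀) ⊎ (f P ≡ suc x₀ × f (suc P) ≡ x₀) → DominatingCut
    cut-at-crossing P P<n₀ g≡1 halves with Crossing.dominating-near-crossing P P<n₀ A-jump (balanced-at-halves P halves)
      where
      A-jump : A (suc P) ≡ suc (A P)
      A-jump = trans (A-gap (n≤1+n P)) (trans (cong (A P +_) g≡1) (+-comm (A P) 1))
    ... | t , t≤K , dominating = cut-at t≤K dominating

    dominating-cut : DominatingCut
    dominating-cut with f 0 ≤? x₀ | f n₀ ≤? x₀
    ... | yes f0≤x₀ | yes fn₀≤x₀ with balanced-at-source source-balanced
      where
      source-balanced : Balanced n₀ 0
      source-balanced rewrite y-small f0≤x₀ | y-small fn₀≤x₀ = ≤-reflexive (trans (sym f-source) (+-comm (f 0) (f n₀)))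
    ...   | t , t≤K , dominating = cut-at t≤K dominating
    dominating-cut | yes f0≤x₀ | no fn₀≰x₀ with crossing-up f n₀ f0≤x₀ (≰⇒> fn₀≰x₀)
    ... | P , P<n₀ , fP≤x₀ , x₀<fP+1 with straddle fP≤x₀ x₀<fP+1 (Consistent.f-stepʳ (consistent (n≤1+n P))) (gap≤1 P)
    ...   | fP≡x₀ , fP+1≡1+x₀ , g≡1 = cut-at-crossing P P<n₀ g≡1 (inj₁ (fP≡x₀ , fP+1≡1+x₀))
    dominating-cut | no f0≰x₀ | yes fn₀≤x₀ with crossing-down f n₀ (≰⇒> f0≰x₀) fn₀≤x₀
    ... | P , P<n₀ , x₀<fP , fP+1≤x₀ with straddle fP+1≤x₀ x₀<fP (Consistent.f-stepˡ (consistent (n≤1+n P))) (gap≤1 P)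
    ...   | fP+1≡x₀ , fP≡1+x₀ , g≡1 = cut-at-crossing P P<n₀ g≡1 (inj₂ (fP≡1+x₀ , fP+1≡x₀))
    dominating-cut | no f0≰x₀ | no fn₀≰x₀ = contradiction (sym f-source) (<⇒≢ (begin-strict
      K                  ≡⟨ sym x₀+⌈K/2⌉≡K ⟩
      x₀ + ⌈ K /2⌉       ≤⟨ +-monoʳ-≤ x₀ ⌈K/2⌉≤1+x₀ ⟩
      x₀ + suc x₀        <⟨ +-monoˡ-< (suc x₀) (n<1+n x₀) ⟩
      suc x₀ + suc x₀    ≤⟨ +-mono-≤ (≰⇒> f0≰x₀) (≰⇒> fn₀≰x₀) ⟩
      f 0 + f n₀         ∎))
      where open ≤-Reasoning

module Sums where

  open import Data.Nat
  open import Data.Nat.Properties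
  open import Data.Nat.ListAction using (sum)
  open import Data.Bool using (true; false)
  open import Data.List using ([]; _∷_; map; foldr; allFin)
  open import Data.List.Properties using (map-tabulate)
  open import Data.Fin using (Fin; zero; suc)
  open import Data.Fin.Properties using () renaming (_≟_ to _≟ᶠ_)
  open import Data.Fin.Subset using (Subset; ∣_∣)
  open import Data.Fin.Subset.Properties using (_∈?_)
  open import Data.Vec using (_∷_; [])
  open import Data.Rational as ℚ using (ℚ; 0ℚ)
  import Data.Rational.Properties as ℚ
  open import Data.Integer as ℤ using (+≤+)
  import Data.Integer.Properties as ℤ
  import Data.Nat.Coprimality as C
  open import Function using (_∘_; id)
  open import Relation.Binary.PropositionalEquality
  open import Relation.Nullary using (does)
  open import Algebra.Properties.CommutativeSemigroup +-commutativeSemigroup using (interchange)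
  open Routes using (⟦_⟧)
  open import Defs using (ℕtoℚ)

  module _ {A : Set} where

    sum-mono : ∀ {f g : A → ℕ} xs → (∀ x → f x ≤ g x) → sum (map f xs) ≤ sum (map g xs)
    sum-mono [] _ = z≤n
    sum-mono (x ∷ xs) f≤g = +-mono-≤ (f≤g x) (sum-mono xs f≤g)

    sum-cong : ∀ {f g : A → ℕ} xs → (∀ x → f x ≡ g x) → sum (map f xs) ≡ sum (map g xs)
    sum-cong [] _ = refl
    sum-cong (x ∷ xs) f≡g = cong₂ _+_ (f≡g x) (sum-cong xs f≡g)

    sum-+ : ∀ (f g : A → ℕ) xs → sum (map (λ x → f x + g x) xs) ≡ sum (map f xs) + sum (map g xs)
    sum-+ f g [] = refl
    sum-+ f g (x ∷ xs) = trans (cong ((f x + g x) +_) (sum-+ f g xs)) (interchange (f x) (g x) _ _)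

    sumℚ-mono : ∀ {f g : A → ℚ} xs → (∀ x → f x ℚ.≤ g x) →
                foldr ℚ._+_ 0ℚ (map f xs) ℚ.≤ foldr ℚ._+_ 0ℚ (map g xs)
    sumℚ-mono [] _ = ℚ.≤-refl
    sumℚ-mono (x ∷ xs) f≤g = ℚ.+-mono-≤ (f≤g x) (sumℚ-mono xs f≤g)

  sum-allFin-suc : ∀ {n} (f : Fin (suc n) → ℕ) → sum (map f (allFin (suc n))) ≡ f zero + sum (map (f ∘ suc) (allFin n))
  sum-allFin-suc {n} f = cong (λ xs → f zero + sum xs) (trans (map-tabulate suc f) (sym (map-tabulate id (f ∘ suc))))

  count-≟ : ∀ {n} (x : Fin n) → sum (map (λ j → ⟦ does (j ≟ᶠ x) ⟧) (allFin n)) ≡ 1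
  count-≟ {suc n} zero = trans (sum-allFin-suc {n} (λ j → ⟦ does (j ≟ᶠ zero) ⟧)) (cong suc (sum-zero (allFin n)))
    where
    sum-zero : ∀ xs → sum (map (λ j → ⟦ does (suc {n} j ≟ᶠ zero) ⟧) xs) ≡ 0
    sum-zero [] = refl
    sum-zero (_ ∷ xs) = sum-zero xs
  count-≟ {suc n} (suc x) = trans (sum-allFin-suc {n} (λ j → ⟦ does (j ≟ᶠ suc x) ⟧)) (count-≟ x)

  count-∈ : ∀ {n} (W : Subset n) → sum (map (λ j → ⟦ does (j ∈? W) ⟧) (allFin n)) ≡ ∣ W ∣
  count-∈ [] = refl
  count-∈ {suc n} (true ∷ W) = trans (sum-allFin-suc {n} (λ j → ⟦ does (j ∈? (true ∷ W)) ⟧)) (cong suc (count-∈ W))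
  count-∈ {suc n} (false ∷ W) = trans (sum-allFin-suc {n} (λ j → ⟦ does (j ∈? (false ∷ W)) ⟧)) (count-∈ W)

  ℕtoℚ≡mkℚ : ∀ m → ℕtoℚ m ≡ ℚ.mkℚ (ℤ.+ m) 0 (C.sym (C.1-coprimeTo m))
  ℕtoℚ≡mkℚ m = ℚ.normalize-coprime (C.sym (C.1-coprimeTo m))

  ℕtoℚ-mono : ∀ {a b} → a ≤ b → ℕtoℚ a ℚ.≤ ℕtoℚ b
  ℕtoℚ-mono {a} {b} a≤b = subst₂ ℚ._≤_ (sym (ℕtoℚ≡mkℚ a)) (sym (ℕtoℚ≡mkℚ b))
    (ℚ.*≤* (subst₂ ℤ._≤_ (sym (ℤ.*-identityʳ (ℤ.+ a))) (sym (ℤ.*-identityʳ (ℤ.+ b))) (+≤+ a≤b)))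

module Cycle where

  open import Defs using (Joins; nextℕ; Walk; [_]; step; verts; edges; uses)
  open LineWalks
  open import Data.Nat
  open import Data.Nat.Properties
  open import Data.Nat.DivMod
  open import Data.Nat.Tactic.RingSolver using (solve-∀)
  open import Data.Fin using (Fin; toℕ)
  open import Data.Fin.Properties using (toℕ-injective; toℕ-fromℕ<; toℕ<n)
  open import Data.Bool using (true; false; T; _∧_)
  open import Data.Bool.Properties using (T-∨; T-∧; T-≡; ⇔→≡)
  open import Data.List using ([]; _∷_; map)
  open import Data.List.Membership.Propositional using (_∈_; _∉_)
  open import Data.List.Membership.Propositional.Properties using (∈-map⁺; ∈-map⁻)
  open import Data.List.Relation.Unary.Any using (here; there)
  open import Data.List.Relation.Unary.All as All using (All; []; _∷_)
  open import Data.List.Relation.Unary.AllPairs using (_∷_)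
  open import Data.List.Relation.Unary.Unique.Propositional using (Unique)
  open import Data.List.Relation.Unary.Unique.Propositional.Properties using (map⁺; map⁻)
  open import Data.Product using (Σ; _×_; _,_; proj₁; proj₂)
  open import Data.Sum using (_⊎_; inj₁; inj₂)
  open import Function.Bundles using (Equivalence; _⇔_; mk⇔)
  open import Function.Properties.Equivalence using () renaming (trans to ⇔-trans; sym to ⇔-sym)
  open import Data.Empty using (⊥; ⊥-elim)
  open import Relation.Nullary.Reflects using (ofʸ; ofⁿ)
  open Routes using (crossing; crossing-clockwise; crossing-anticlockwise)
  open import Relation.Binary.PropositionalEquality
  open import Relation.Nullary using (yes; no)
  open import Relation.Nullary.Negation using (contradiction)
  open import Function using (_∘_)
  open import Algebra.Properties.CommutativeSemigroup +-commutativeSemigroup using (xy∙z≈xz∙y)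

  module Ring (n₀ : ℕ) .{{_ : NonZero n₀}} where

    n : ℕ
    n = suc n₀

    [a%n+b]%n≡[a+b]%n : ∀ a b → (a % n + b) % n ≡ (a + b) % n
    [a%n+b]%n≡[a+b]%n a b = begin
      (a % n + b) % n             ≡⟨ %-distribˡ-+ (a % n) b n ⟩
      (a % n % n + b % n) % n     ≡⟨ cong (λ z → (z + b % n) % n) (m%n%n≡m%n a n) ⟩
      (a % n + b % n) % n         ≡⟨ sym (%-distribˡ-+ a b n) ⟩
      (a + b) % n                 ∎
      where open ≡-Reasoning

    [a+b%n]%n≡[a+b]%n : ∀ a b → (a + b % n) % n ≡ (a + b) % n
    [a+b%n]%n≡[a+b]%n a b = begin
      (a + b % n) % n   ≡⟨ cong (_% n) (+-comm a (b % n)) ⟩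
      (b % n + a) % n   ≡⟨ [a%n+b]%n≡[a+b]%n b a ⟩
      (b + a) % n       ≡⟨ cong (_% n) (+-comm b a) ⟩
      (a + b) % n       ∎
      where open ≡-Reasoning

    toℕ-mod : ∀ a → toℕ (a mod n) ≡ a % n
    toℕ-mod a = toℕ-fromℕ< (m%n<n a n)

    next : Fin n → Fin n
    next x = suc (toℕ x) mod n

    toℕ-next : ∀ x → toℕ (next x) ≡ nextℕ n (toℕ x)
    toℕ-next x with suc (toℕ x) ≡ᵇ n in eq
    ... | true  = trans (toℕ-mod (suc (toℕ x))) (trans (cong (_% n) (≡ᵇ⇒≡ (suc (toℕ x)) n (subst T (sym eq) _))) (n%n≡0 n))
    ... | false = trans (toℕ-mod (suc (toℕ x))) (m<n⇒m%n≡m (≤∧≢⇒< (toℕ<n x) (λ 1+x≡n → subst T eq (≡⇒≡ᵇ _ _ 1+x≡n))))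

    forward⇔ : ∀ {e x y} → T ((toℕ x ≡ᵇ toℕ e) ∧ (toℕ y ≡ᵇ nextℕ n (toℕ e))) ⇔ (x ≡ e × y ≡ next e)
    forward⇔ {e} = mk⇔
      (λ t → let (x≡e , y≡e+1) = Equivalence.to T-∧ t in
             toℕ-injective (≡ᵇ⇒≡ _ _ x≡e) , toℕ-injective (trans (≡ᵇ⇒≡ _ _ y≡e+1) (sym (toℕ-next e))))
      (λ { (refl , refl) → Equivalence.from T-∧ (≡⇒≡ᵇ (toℕ e) (toℕ e) refl , ≡⇒≡ᵇ _ _ (toℕ-next e)) })

    joins⇒ : ∀ {e x y} → Joins n e x y → (x ≡ e × y ≡ next e) ⊎ (y ≡ e × x ≡ next e)
    joins⇒ J with Equivalence.to T-∨ J
    ... | inj₁ t = inj₁ (Equivalence.to forward⇔ t)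
    ... | inj₂ t = inj₂ (Equivalence.to forward⇔ t)

    joins-forward : ∀ e → Joins n e e (next e)
    joins-forward e = Equivalence.from (T-∨ {(toℕ e ≡ᵇ toℕ e) ∧ _}) (inj₁ (Equivalence.from (forward⇔ {e}) (refl , refl)))

    joins-backward : ∀ e → Joins n e (next e) e
    joins-backward e = Equivalence.from (T-∨ {(toℕ (next e) ≡ᵇ toℕ e) ∧ _}) (inj₂ (Equivalence.from (forward⇔ {e}) (refl , refl)))

    -- The position of x when the cycle is read from the vertex numbered (− r) mod n.
    coord : ℕ → Fin n → ℕ
    coord r x = (toℕ x + r) % n

    -- Adding n₀ * r undoes the rotation by r, since n₀ * r + r = r * n.
    atCoord : ℕ → ℕ → Fin n
    atCoord r a = (a + n₀ * r) mod n

    coord<n : ∀ r x → coord r x < n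
    coord<n r x = m%n<n (toℕ x + r) n

    undo-rotation : ∀ a r → (a + n₀ * r + r) % n ≡ a % n
    undo-rotation a r = trans (cong (_% n) (rearrange a r n₀)) ([m+kn]%n≡m%n a r n)
      where
      rearrange : ∀ a r n₀ → a + n₀ * r + r ≡ a + r * suc n₀
      rearrange = solve-∀

    coord-atCoord : ∀ r {a} → a < n → coord r (atCoord r a) ≡ a
    coord-atCoord r {a} a<n = begin
      (toℕ (atCoord r a) + r) % n     ≡⟨ cong (λ z → (z + r) % n) (toℕ-mod (a + n₀ * r)) ⟩
      ((a + n₀ * r) % n + r) % n      ≡⟨ [a%n+b]%n≡[a+b]%n (a + n₀ * r) r ⟩
      (a + n₀ * r + r) % n            ≡⟨ undo-rotation a r ⟩
      a % n                           ≡⟨ m<n⇒m%n≡m a<n ⟩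
      a                               ∎
      where open ≡-Reasoning

    atCoord-coord : ∀ r x → atCoord r (coord r x) ≡ x
    atCoord-coord r x = toℕ-injective (begin
      toℕ (atCoord r (coord r x))           ≡⟨ toℕ-mod (coord r x + n₀ * r) ⟩
      ((toℕ x + r) % n + n₀ * r) % n        ≡⟨ [a%n+b]%n≡[a+b]%n (toℕ x + r) (n₀ * r) ⟩
      (toℕ x + r + n₀ * r) % n              ≡⟨ cong (_% n) (xy∙z≈xz∙y (toℕ x) r (n₀ * r)) ⟩
      (toℕ x + n₀ * r + r) % n              ≡⟨ undo-rotation (toℕ x) r ⟩
      toℕ x % n                             ≡⟨ m<n⇒m%n≡m (toℕ<n x) ⟩
      toℕ x                                 ∎)
      where open ≡-Reasoning

    coord-injective : ∀ r {x y} → coord r x ≡ coord r y → x ≡ y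
    coord-injective r {x} {y} eq = trans (sym (atCoord-coord r x)) (trans (cong (atCoord r) eq) (atCoord-coord r y))

    coord-next : ∀ r x → coord r (next x) ≡ suc (coord r x) % n
    coord-next r x = begin
      (toℕ (next x) + r) % n          ≡⟨ cong (λ z → (z + r) % n) (toℕ-mod (suc (toℕ x))) ⟩
      (suc (toℕ x) % n + r) % n       ≡⟨ [a%n+b]%n≡[a+b]%n (suc (toℕ x)) r ⟩
      (1 + (toℕ x + r)) % n           ≡⟨ sym ([a+b%n]%n≡[a+b]%n 1 (toℕ x + r)) ⟩
      suc (coord r x) % n             ∎
      where open ≡-Reasoning

    coord-next-inner : ∀ r x → coord r x ≢ n₀ → coord r (next x) ≡ suc (coord r x)
    coord-next-inner r x x≢n₀ = trans (coord-next r x) (m<n⇒m%n≡m (s≤s (≤∧≢⇒< (≤-pred (coord<n r x)) x≢n₀)))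

    coord-next-wrap : ∀ r x → coord r x ≡ n₀ → coord r (next x) ≡ 0
    coord-next-wrap r x x≡n₀ = trans (coord-next r x) (trans (cong (λ z → suc z % n) x≡n₀) (n%n≡0 n))

    next-atCoord : ∀ r {a} → suc a < n → next (atCoord r a) ≡ atCoord r (suc a)
    next-atCoord r {a} a+1<n = coord-injective r (begin
      coord r (next (atCoord r a))      ≡⟨ coord-next r (atCoord r a) ⟩
      suc (coord r (atCoord r a)) % n   ≡⟨ cong (λ z → suc z % n) (coord-atCoord r (<-trans (n<1+n a) a+1<n)) ⟩
      suc a % n                         ≡⟨ m<n⇒m%n≡m a+1<n ⟩
      suc a                             ≡⟨ sym (coord-atCoord r a+1<n) ⟩
      coord r (atCoord r (suc a))       ∎)
      where open ≡-Reasoning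

    coord-+ : ∀ r s x → coord (r + s) x ≡ (coord r x + s) % n
    coord-+ r s x = trans (cong (_% n) (sym (+-assoc (toℕ x) r s))) (sym ([a%n+b]%n≡[a+b]%n (toℕ x + r) s))

    uses⇔∈edges : ∀ {u w} e (p : Walk n u w) → T (uses e p) ⇔ e ∈ edges p
    uses⇔∈edges e p = mk⇔ (to p) (from p)
      where
      to : ∀ {u w} (p : Walk n u w) → T (uses e p) → e ∈ edges p
      to (step u e' J p) t with toℕ e ≡ᵇ toℕ e' in eq
      ... | true  = here (toℕ-injective (≡ᵇ⇒≡ _ _ (subst T (sym eq) _)))
      ... | false = there (to p t)
      from : ∀ {u w} (p : Walk n u w) → e ∈ edges p → T (uses e p)
      from (step u e' J p) (here refl) with toℕ e ≡ᵇ toℕ e | ≡⇒≡ᵇ (toℕ e) (toℕ e) refl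
      ... | true | _ = _
      from (step u e' J p) (there m) with toℕ e ≡ᵇ toℕ e'
      ... | true  = _
      ... | false = from p m

    Traces : ∀ r {u w a b} → Walk n u w → LineWalk a b → Set
    Traces r p l = map (coord r) (verts p) ≡ lineVertices l × map (coord r) (edges p) ≡ lineEdges l

    toLineWalk : ∀ r {u w} (p : Walk n u w) → All (λ e → coord r e ≢ n₀) (edges p) →
                 Σ (LineWalk (coord r u) (coord r w)) (Traces r p)
    toLineWalk r [ v ] _ = stop (coord r v) , refl , refl
    toLineWalk r (step u {v} e J p) (e≢n₀ ∷ avoids) with toLineWalk r p avoids | joins⇒ {e} {u} {v} J
    ... | l , vs , es | inj₁ (refl , refl) =
      up (castStart step≡ l) ,
      cong (coord r e ∷_) (trans vs (sym (lineVertices-castStart step≡ l))) ,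
      cong (coord r e ∷_) (trans es (sym (lineEdges-castStart step≡ l)))
      where
      step≡ : coord r (next e) ≡ suc (coord r e)
      step≡ = coord-next-inner r e e≢n₀
    ... | l , vs , es | inj₂ (refl , refl) =
      castStart (sym step≡) (down l) ,
      trans (cong₂ _∷_ step≡ vs) (sym (lineVertices-castStart (sym step≡) (down l))) ,
      trans (cong (coord r e ∷_) es) (sym (lineEdges-castStart (sym step≡) (down l)))
      where
      step≡ : coord r (next e) ≡ suc (coord r e)
      step≡ = coord-next-inner r e e≢n₀

    fromLineWalk : ∀ r {a b} (l : LineWalk a b) → All (_< n) (lineVertices l) →
                   Σ (Walk n (atCoord r a) (atCoord r b)) λ p → Traces r p l
    fromLineWalk r (stop a) (a<n ∷ []) = [ atCoord r a ] , cong (_∷ []) (coord-atCoord r a<n) , refl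
    fromLineWalk r (up {a} l) (a<n ∷ bounded) with fromLineWalk r l bounded
    ... | p , vs , es = step (atCoord r a) (atCoord r a) joins p , cong₂ _∷_ (coord-atCoord r a<n) vs , cong₂ _∷_ (coord-atCoord r a<n) es
      where
      joins : Joins n (atCoord r a) (atCoord r a) (atCoord r (suc a))
      joins = subst (Joins n (atCoord r a) (atCoord r a)) (next-atCoord r (All.lookup bounded (lineVertices-start l))) (joins-forward (atCoord r a))
    fromLineWalk r (down {a} l) (a+1<n ∷ bounded) with fromLineWalk r l bounded
    ... | p , vs , es = step (atCoord r (suc a)) (atCoord r a) joins p ,
                        cong₂ _∷_ (coord-atCoord r a+1<n) vs , cong₂ _∷_ (coord-atCoord r (<-trans (n<1+n a) a+1<n)) es
      where
      joins : Joins n (atCoord r a) (atCoord r (suc a)) (atCoord r a)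
      joins = subst (λ z → Joins n (atCoord r a) z (atCoord r a)) (next-atCoord r a+1<n) (joins-backward (atCoord r a))

    traces-simple : ∀ r {u w a b} {p : Walk n u w} {l : LineWalk a b} → Traces r p l → Unique (verts p) → Unique (lineVertices l)
    traces-simple r (vs , _) u = subst Unique vs (map⁺ (coord-injective r) u)

    traced-vertices⇒ : ∀ r {u w} {p : Walk n u w} {l : LineWalk (coord r u) (coord r w)} → Traces r p l → Unique (lineVertices l) →
                       ∀ {v} → v ∈ verts p → Between (coord r v) (coord r u) (coord r w)
    traced-vertices⇒ r {l = l} (vs , _) simple v∈p = simple-vertices⇒ l simple (subst (_ ∈_) vs (∈-map⁺ (coord r) v∈p))

    traced-edges⇔ : ∀ r {u w} {p : Walk n u w} {l : LineWalk (coord r u) (coord r w)} → Traces r p l → Unique (lineVertices l) →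
                    ∀ {e} → e ∈ edges p ⇔ EdgeBetween (coord r e) (coord r u) (coord r w)
    traced-edges⇔ r {p = p} {l} (_ , es) simple {e} = mk⇔
      (λ e∈p → simple-edges⇒ l simple (subst (_ ∈_) es (∈-map⁺ (coord r) e∈p)))
      (λ between → preimage (∈-map⁻ (coord r) (subst (coord r e ∈_) (sym es) (crosses-between l between))))
      where
      preimage : Σ (Fin n) (λ e' → e' ∈ edges p × coord r e ≡ coord r e') → e ∈ edges p
      preimage (e' , e'∈p , same) = subst (_∈ edges p) (sym (coord-injective r same)) e'∈p

    T-⇔⇒≡ : ∀ {x y} → T x ⇔ T y → x ≡ y
    T-⇔⇒≡ x⇔y = ⇔→≡ (⇔-trans (⇔-sym T-≡) (⇔-trans x⇔y T-≡))

    castWalk : ∀ {x x' y y'} → x ≡ x' → y ≡ y' → Walk n x y → Walk n x' y'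
    castWalk refl refl p = p

    traces-castWalk : ∀ r {x x' y y' a b} (ex : x ≡ x') (ey : y ≡ y') {p : Walk n x y} {l : LineWalk a b} →
                      Traces r p l → Traces r (castWalk ex ey p) l
    traces-castWalk r refl refl t = t

    straight-bounded : ∀ r x y → All (_< n) (lineVertices (straight (coord r x) (coord r y)))
    straight-bounded r x y = All.tabulate λ z∈l → bounded (simple-vertices⇒ (straight _ _) (straight-simple _ _) z∈l)
      where
      bounded : ∀ {z} → Between z (coord r x) (coord r y) → z < n
      bounded (inj₁ (_ , z≤y)) = ≤-<-trans z≤y (coord<n r y)
      bounded (inj₂ (_ , z≤x)) = ≤-<-trans z≤x (coord<n r x)

    straightWalk : ∀ r x y → Σ (Walk n x y) λ p → Traces r p (straight (coord r x) (coord r y))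
    straightWalk r x y with fromLineWalk r (straight (coord r x) (coord r y)) (straight-bounded r x y)
    ... | p , t = castWalk (atCoord-coord r x) (atCoord-coord r y) p , traces-castWalk r (atCoord-coord r x) (atCoord-coord r y) t

    straightWalk-simple : ∀ r x y → Unique (verts (proj₁ (straightWalk r x y)))
    straightWalk-simple r x y = map⁻ (subst Unique (sym (proj₁ (proj₂ (straightWalk r x y)))) (straight-simple _ _))

    start∈verts : ∀ {u w} (p : Walk n u w) → u ∈ verts p
    start∈verts [ v ] = here refl
    start∈verts (step u e J p) = here refl

    avoids-vertex : ∀ x {u w} (p : Walk n u w) → x ∉ verts p → All (λ e → e ≢ x × next e ≢ x) (edges p)
    avoids-vertex x [ v ] x∉p = []
    avoids-vertex x (step u {v} e J p) x∉p with joins⇒ {e} {u} {v} J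
    ... | inj₁ (refl , refl) = ((λ e≡x → x∉p (here (sym e≡x))) , (λ e+1≡x → x∉p (there (subst (_∈ verts p) e+1≡x (start∈verts p)))))
                               ∷ avoids-vertex x p (x∉p ∘ there)
    ... | inj₂ (refl , refl) = ((λ e≡x → x∉p (there (subst (_∈ verts p) e≡x (start∈verts p)))) , (λ e+1≡x → x∉p (here (sym e+1≡x))))
                               ∷ avoids-vertex x p (x∉p ∘ there)

    module Rooted (i : Fin n) where

      position : Fin n → ℕ
      position = coord (n ∸ toℕ i)

      position-i : position i ≡ 0
      position-i = trans (cong (_% n) (m+[n∸m]≡n (<⇒≤ (toℕ<n i)))) (n%n≡0 n)

      position-injective : ∀ {x y} → position x ≡ position y → x ≡ y
      position-injective = coord-injective _

      position≤n₀ : ∀ x → position x ≤ n₀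
      position≤n₀ x = ≤-pred (coord<n _ x)

      -- Cutting the edge at position c unrolls the cycle into a line starting at position c + 1.
      cutShift : ℕ → ℕ
      cutShift c = n ∸ toℕ i + (n₀ ∸ c)

      cutCoord : ℕ → Fin n → ℕ
      cutCoord c = coord (cutShift c)

      cutCoord-below : ∀ {c} x → c ≤ n₀ → position x ≤ c → cutCoord c x ≡ position x + (n₀ ∸ c)
      cutCoord-below {c} x c≤n₀ x≤c = trans (coord-+ _ (n₀ ∸ c) x)
        (m<n⇒m%n≡m (s≤s (≤-trans (+-monoˡ-≤ (n₀ ∸ c) x≤c) (≤-reflexive (m+[n∸m]≡n c≤n₀)))))

      cutCoord-above : ∀ {c} x → c ≤ n₀ → c < position x → cutCoord c x ≡ position x ∸ suc c
      cutCoord-above {c} x c≤n₀ c<x = begin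
        cutCoord c x                          ≡⟨ coord-+ _ (n₀ ∸ c) x ⟩
        (position x + (n₀ ∸ c)) % n           ≡⟨ cong (_% n) shift ⟩
        (position x ∸ suc c + n) % n          ≡⟨ [m+n]%n≡m%n (position x ∸ suc c) n ⟩
        (position x ∸ suc c) % n              ≡⟨ m<n⇒m%n≡m (≤-<-trans (m∸n≤m (position x) (suc c)) (coord<n _ x)) ⟩
        position x ∸ suc c                    ∎
        where
        open ≡-Reasoning
        shift : position x + (n₀ ∸ c) ≡ position x ∸ suc c + n
        shift = begin
          position x + (n₀ ∸ c)                           ≡⟨ cong (_+ (n₀ ∸ c)) (sym (m+[n∸m]≡n c<x)) ⟩
          suc c + (position x ∸ suc c) + (n₀ ∸ c)         ≡⟨ rearrange c (position x ∸ suc c) (n₀ ∸ c) ⟩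
          position x ∸ suc c + suc (c + (n₀ ∸ c))         ≡⟨ cong (λ z → position x ∸ suc c + suc z) (m+[n∸m]≡n c≤n₀) ⟩
          position x ∸ suc c + n                          ∎
          where
          rearrange : ∀ c d w → suc c + d + w ≡ d + suc (c + w)
          rearrange = solve-∀

      cutCoord-i : ∀ {c} → c ≤ n₀ → cutCoord c i ≡ n₀ ∸ c
      cutCoord-i {c} c≤n₀ = trans (cutCoord-below i c≤n₀ (subst (_≤ c) (sym position-i) z≤n)) (cong (_+ (n₀ ∸ c)) position-i)

      simple-walk-avoids-cut : ∀ {j} → j ≢ i → (p : Walk n i j) → Unique (verts p) →
                               Σ ℕ λ c → c ≤ n₀ × All (λ e → cutCoord c e ≢ n₀) (edges p)
      simple-walk-avoids-cut j≢i [ _ ] _ = contradiction refl j≢i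
      simple-walk-avoids-cut j≢i (step _ {v} e J p) (i∉p ∷ simple) with joins⇒ {e} {i} {v} J
      ... | inj₁ (refl , refl) = n₀ , ≤-refl , first ∷ All.map rest (avoids-vertex i p (λ i∈p → All.lookup i∉p i∈p refl))
        where
        i↦0 : cutCoord n₀ i ≡ 0
        i↦0 = trans (cutCoord-i ≤-refl) (n∸n≡0 n₀)
        first : cutCoord n₀ i ≢ n₀
        first i↦n₀ = ≢-nonZero⁻¹ n₀ (trans (sym i↦n₀) i↦0)
        rest : ∀ {e'} → e' ≢ i × next e' ≢ i → cutCoord n₀ e' ≢ n₀
        rest (_ , e'+1≢i) e'↦n₀ = e'+1≢i (coord-injective _ (trans (coord-next-wrap _ _ e'↦n₀) (sym i↦0)))
      ... | inj₂ (refl , i≡e+1) = 0 , z≤n , first ∷ All.map rest (avoids-vertex i p (λ i∈p → All.lookup i∉p i∈p refl))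
        where
        i↦n₀ : cutCoord 0 i ≡ n₀
        i↦n₀ = cutCoord-i z≤n
        first : cutCoord 0 e ≢ n₀
        first e↦n₀ = ≢-nonZero⁻¹ n₀ (trans (sym i↦n₀) (trans (cong (cutCoord 0) i≡e+1) (coord-next-wrap _ e e↦n₀)))
        rest : ∀ {e'} → e' ≢ i × next e' ≢ i → cutCoord 0 e' ≢ n₀
        rest (e'≢i , _) e'↦n₀ = e'≢i (coord-injective _ (trans e'↦n₀ (sym i↦n₀)))

      above-cut<n₀∸c : ∀ {c a} → c < a → a ≤ n₀ → a ∸ suc c < n₀ ∸ c
      above-cut<n₀∸c {c} {a} c<a a≤n₀ = +-cancelʳ-≤ (suc c) (suc (a ∸ suc c)) (n₀ ∸ c) (begin
        suc (a ∸ suc c) + suc c   ≡⟨ cong suc (m∸n+n≡m c<a) ⟩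
        suc a                     ≤⟨ s≤s a≤n₀ ⟩
        suc n₀                    ≡⟨ cong suc (sym (m∸n+n≡m (≤-trans (n≤1+n c) (≤-trans c<a a≤n₀)))) ⟩
        suc (n₀ ∸ c + c)          ≡⟨ sym (+-suc (n₀ ∸ c) c) ⟩
        n₀ ∸ c + suc c            ∎)
        where open ≤-Reasoning

      clockwise-crossing⇔ : ∀ {c j} → c ≤ n₀ → position j ≤ c → ∀ e →
                            EdgeBetween (cutCoord c e) (cutCoord c i) (cutCoord c j) ⇔ T (crossing true (position j ≤ᵇ position e))
      clockwise-crossing⇔ {c} {j} c≤n₀ j≤c e rewrite cutCoord-i c≤n₀ | cutCoord-below j c≤n₀ j≤c with position e ≤? c
      ... | yes e≤c rewrite cutCoord-below e c≤n₀ e≤c = ⇔-trans (mk⇔ to from) (⇔-sym crossing-clockwise)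
        where
        w : ℕ
        w = n₀ ∸ c
        to : EdgeBetween (position e + w) w (position j + w) → position e < position j
        to (inj₁ (_ , e<j)) = +-cancelʳ-< _ _ _ e<j
        to (inj₂ (_ , e+w<w)) = contradiction (m≤n+m w (position e)) (<⇒≱ e+w<w)
        from : position e < position j → EdgeBetween (position e + w) w (position j + w)
        from e<j = inj₁ (m≤n+m w (position e) , +-monoˡ-< w e<j)
      ... | no e≰c rewrite cutCoord-above e c≤n₀ (≰⇒> e≰c) =
        mk⇔ (⊥-elim ∘ to) (λ t → contradiction (≤-trans j≤c (<⇒≤ (≰⇒> e≰c))) (<⇒≱ (Equivalence.to crossing-clockwise t)))
        where
        w : ℕ
        w = n₀ ∸ c
        e<w : position e ∸ suc c < w
        e<w = above-cut<n₀∸c (≰⇒> e≰c) (position≤n₀ e)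
        to : EdgeBetween (position e ∸ suc c) w (position j + w) → ⊥
        to (inj₁ (w≤e , _)) = <⇒≱ e<w w≤e
        to (inj₂ (j+w≤e , _)) = <⇒≱ e<w (≤-trans (m≤n+m w (position j)) j+w≤e)

      anticlockwise-crossing⇔ : ∀ {c j} → c ≤ n₀ → c < position j → ∀ e →
                                EdgeBetween (cutCoord c e) (cutCoord c i) (cutCoord c j) ⇔ T (crossing false (position j ≤ᵇ position e))
      anticlockwise-crossing⇔ {c} {j} c≤n₀ c<j e rewrite cutCoord-i c≤n₀ | cutCoord-above j c≤n₀ c<j with position e ≤? c
      ... | yes e≤c rewrite cutCoord-below e c≤n₀ e≤c =
        mk⇔ (⊥-elim ∘ to) (λ t → contradiction (≤-trans (Equivalence.to crossing-anticlockwise t) e≤c) (<⇒≱ c<j))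
        where
        w : ℕ
        w = n₀ ∸ c
        j<w : position j ∸ suc c < w
        j<w = above-cut<n₀∸c c<j (position≤n₀ j)
        to : EdgeBetween (position e + w) w (position j ∸ suc c) → ⊥
        to (inj₁ (_ , e+w<j)) = <⇒≱ (<-trans e+w<j j<w) (m≤n+m w (position e))
        to (inj₂ (_ , e+w<w)) = <⇒≱ e+w<w (m≤n+m w (position e))
      ... | no e≰c rewrite cutCoord-above e c≤n₀ (≰⇒> e≰c) = ⇔-trans (mk⇔ to from) (⇔-sym crossing-anticlockwise)
        where
        w : ℕ
        w = n₀ ∸ c
        to : EdgeBetween (position e ∸ suc c) w (position j ∸ suc c) → position j ≤ position e
        to (inj₁ (w≤e , e<j)) = contradiction (<-trans e<j (above-cut<n₀∸c c<j (position≤n₀ j))) (≤⇒≯ w≤e)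
        to (inj₂ (j≤e , _)) = subst₂ _≤_ (m∸n+n≡m c<j) (m∸n+n≡m (≰⇒> e≰c)) (+-monoˡ-≤ (suc c) j≤e)
        from : position j ≤ position e → EdgeBetween (position e ∸ suc c) w (position j ∸ suc c)
        from j≤e = inj₂ (∸-monoˡ-≤ (suc c) j≤e , above-cut<n₀∸c (≰⇒> e≰c) (position≤n₀ e))

      -- Cutting at c routes j clockwise exactly when position j ≤ c.
      cut-crossing⇔ : ∀ {c} → c ≤ n₀ → ∀ j e →
                      EdgeBetween (cutCoord c e) (cutCoord c i) (cutCoord c j) ⇔ T (crossing (position j ≤ᵇ c) (position j ≤ᵇ position e))
      cut-crossing⇔ {c} c≤n₀ j e with position j ≤ᵇ c | ≤ᵇ-reflects-≤ (position j) c
      ... | true  | ofʸ j≤c = clockwise-crossing⇔ {j = j} c≤n₀ j≤c e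
      ... | false | ofⁿ j≰c = anticlockwise-crossing⇔ {j = j} c≤n₀ (≰⇒> j≰c) e

      traced-orientation : ∀ {c j} → c ≤ n₀ → {p : Walk n i j} {l : LineWalk (cutCoord c i) (cutCoord c j)} →
                           Traces (cutShift c) p l → Unique (lineVertices l) →
                           ∀ e → uses e p ≡ crossing (position j ≤ᵇ c) (position j ≤ᵇ position e)
      traced-orientation {c} {j} c≤n₀ {p} t simple e =
        T-⇔⇒≡ (⇔-trans (uses⇔∈edges e p) (⇔-trans (traced-edges⇔ (cutShift c) t simple) (cut-crossing⇔ c≤n₀ j e)))

module RingRouting where

  open import Defs
  open Routes
  open LineWalks
  open Cycle
  open LoadProfiles
  open Sums
  open import Data.Nat hiding (_≟_)
  open import Data.Nat.Properties hiding (_≟_)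
  open import Data.Nat.ListAction using (sum)
  open import Data.Fin using (Fin; toℕ)
  open import Data.Fin.Subset using (Subset; _∈_; ∣_∣)
  open import Data.Fin.Subset.Properties using (_∈?_)
  open import Data.Fin.Properties using (_≟_)
  open import Data.Bool using (Bool; true; false)
  open import Data.List using (List; []; _∷_; map; allFin)
  open import Data.Product using (Σ; _,_; proj₁; proj₂)
  open import Data.Sum using (inj₁; inj₂)
  open import Relation.Binary.PropositionalEquality
  open import Relation.Nullary using (yes; no; does)
  open import Relation.Nullary.Negation using (contradiction)
  open import Function.Bundles using (Equivalence; _⇔_; mk⇔)
  open import Data.List.Relation.Unary.All as All using (All)
  open import Data.List.Membership.Propositional using () renaming (_∈_ to _∈ₗ_)
  open import Data.List.Properties using (map-injective)

  module PyramidalRouting (n₀ : ℕ) .{{_ : NonZero n₀}} (i : Fin (suc n₀)) (W : Subset (suc n₀)) (i∈W : i ∈ W) where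

    open Ring n₀
    open Rooted i

    destination : Fin n → Bool
    destination j with j ∈? W | j ≟ i
    ... | yes _ | no _ = true
    ... | _     | _    = false

    destination⇒≢i : ∀ j → destination j ≡ true → j ≢ i
    destination⇒≢i j with j ∈? W | j ≟ i
    ... | yes _ | no j≢i = λ _ → j≢i
    ... | yes _ | yes _  = λ ()
    ... | no _  | _      = λ ()

    Orientation : Set
    Orientation = ∀ j → j ∈ W → j ≢ i → Bool

    record Oriented (P : Solution n W i) (b : Orientation) : Set where
      field
        uses≡crossing : ∀ j (j∈W : j ∈ W) (j≢i : j ≢ i) e →
                        uses e (proj₁ (P j j∈W j≢i)) ≡ crossing (b j j∈W j≢i) (position j ≤ᵇ position e)
    open Oriented

    -- The orientation of the path that Defs.load counts for j, with the proofs found by the decision procedures.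
    decided : Orientation → Fin n → Bool
    decided b j with j ∈? W | j ≟ i
    ... | yes j∈W | no j≢i = b j j∈W j≢i
    ... | _       | _      = false

    loads : (Fin n → Bool) → ℕ → ℕ
    loads b p = sum (map (λ j → passes (destination j) (b j) (position j) p) (allFin n))

    arrived : ℕ → ℕ
    arrived p = sum (map (λ j → below (destination j) (position j) p) (allFin n))

    entering : ℕ → ℕ → ℕ
    entering p p' = sum (map (λ j → enters (destination j) (position j) p p') (allFin n))

    K : ℕ
    K = sum (map (λ j → ⟦ destination j ⟧) (allFin n))

    arrived-split : ∀ {p p'} → p ≤ p' → arrived p' ≡ arrived p + entering p p'
    arrived-split p≤p' = trans (sum-cong (allFin n) (λ j → below-split (destination j) (position j) p≤p'))
                                   (sum-+ (λ j → below (destination j) (position j) _) (λ j → enters (destination j) (position j) _ _) (allFin n))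

    consistent : ∀ b {p p'} → p ≤ p' → Consistent K arrived (loads b) p p'
    consistent b {p} {p'} p≤p' = record
      { gap        = entering p p'
      ; A-gap      = arrived-split p≤p'
      ; f-stepʳ    = summed (λ j → passes-stepʳ (destination j) (b j) (position j) p≤p') refl (sum-+ (pass p) enter (allFin n))
      ; f-stepˡ    = summed (λ j → passes-stepˡ (destination j) (b j) (position j) p≤p') refl (sum-+ (pass p') enter (allFin n))
      ; gap≤f+f    = summed (λ j → enters≤passes+passes (destination j) (b j) (position j) p≤p') refl (sum-+ (pass p) (pass p') (allFin n))
      ; f+f+gap≤2K = summed (λ j → passes+passes+enters≤2 (destination j) (b j) (position j) p≤p')
                       (trans (sum-+ (λ j → pass p j + pass p' j) enter (allFin n)) (cong (_+ entering p p') (sum-+ (pass p) (pass p') (allFin n))))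
                       (sum-+ weight weight (allFin n))
      }
      where
      pass : ℕ → Fin n → ℕ
      pass p j = passes (destination j) (b j) (position j) p
      enter : Fin n → ℕ
      enter j = enters (destination j) (position j) p p'
      weight : Fin n → ℕ
      weight j = ⟦ destination j ⟧
      summed : ∀ {f g : Fin n → ℕ} {s t} → (∀ j → f j ≤ g j) → sum (map f (allFin n)) ≡ s → sum (map g (allFin n)) ≡ t → s ≤ t
      summed f≤g refl refl = sum-mono (allFin n) f≤g

    arrived-zero : arrived 0 ≡ 0
    arrived-zero = trans (sum-cong (allFin n) (λ j → below-zero (destination j) (position j) (λ d → 1≤position j (destination⇒≢i j d))))
                         (sum-zero (allFin n))
      where
      1≤position : ∀ j → j ≢ i → 1 ≤ position j
      1≤position j j≢i with position j in eq
      ... | zero  = contradiction (position-injective (trans eq (sym position-i))) j≢i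
      ... | suc _ = s≤s z≤n
      sum-zero : ∀ (js : List (Fin n)) → sum (map (λ _ → 0) js) ≡ 0
      sum-zero [] = refl
      sum-zero (_ ∷ js) = sum-zero js

    arrived-end : arrived n₀ ≡ K
    arrived-end = sum-cong (allFin n) (λ j → below-all (destination j) (position≤n₀ j))

    arrived-step : ∀ p → arrived (suc p) ≤ suc (arrived p)
    arrived-step p = begin
      arrived (suc p)                                        ≡⟨ arrived-split (n≤1+n p) ⟩
      arrived p + entering p (suc p)                         ≤⟨ +-monoʳ-≤ (arrived p) (sum-mono (allFin n) at-most-one) ⟩
      arrived p + sum (map (λ j → ⟦ does (j ≟ v) ⟧) (allFin n)) ≡⟨ cong (arrived p +_) (count-≟ v) ⟩
      arrived p + 1                                          ≡⟨ +-comm (arrived p) 1 ⟩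
      suc (arrived p)                                        ∎
      where
      open ≤-Reasoning
      v : Fin n
      v = atCoord (n ∸ toℕ i) (suc p)
      at-most-one : ∀ j → enters (destination j) (position j) p (suc p) ≤ ⟦ does (j ≟ v) ⟧
      at-most-one j = ≤-trans (enters-step (destination j) (position j) p)
                              (⟦does⟧-mono (position j Data.Nat.≟ suc p) (j ≟ v) (λ j↦p+1 → trans (sym (atCoord-coord _ j)) (cong (atCoord _) j↦p+1)))

    1+K≡∣W∣ : suc K ≡ ∣ W ∣
    1+K≡∣W∣ = begin
      suc K                                                                   ≡⟨ +-comm 1 K ⟩
      K + 1                                                                   ≡⟨ cong (K +_) (sym (count-≟ i)) ⟩
      K + sum (map (λ j → ⟦ does (j ≟ i) ⟧) (allFin n))                        ≡⟨ sym (sum-+ (λ j → ⟦ destination j ⟧) (λ j → ⟦ does (j ≟ i) ⟧) (allFin n)) ⟩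
      sum (map (λ j → ⟦ destination j ⟧ + ⟦ does (j ≟ i) ⟧) (allFin n))        ≡⟨ sum-cong (allFin n) member ⟩
      sum (map (λ j → ⟦ does (j ∈? W) ⟧) (allFin n))                           ≡⟨ count-∈ W ⟩
      ∣ W ∣                                                                   ∎
      where
      open ≡-Reasoning
      member : ∀ j → ⟦ destination j ⟧ + ⟦ does (j ≟ i) ⟧ ≡ ⟦ does (j ∈? W) ⟧
      member j with j ∈? W | j ≟ i
      ... | yes _ | no _     = refl
      ... | yes _ | yes _    = refl
      ... | no _  | no _     = refl
      ... | no j∉W | yes refl = contradiction i∈W j∉W

    -- Exposes the summand of Defs.load, which is defined in a where block, for a case analysis.
    load-summands : ∀ (P : Solution n W i) e → Σ (Fin n → ℕ) λ h → load W i P e ≡ sum (map h (allFin n))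
    load-summands P e = _ , refl

    load≡loads : ∀ {P b} → Oriented P b → ∀ e → load W i P e ≡ loads (decided b) (position e)
    load≡loads {P} {b} oriented e = trans (proj₂ (load-summands P e)) (sum-cong (allFin n) summand)
      where
      summand : ∀ j → proj₁ (load-summands P e) j ≡ passes (destination j) (decided b j) (position j) (position e)
      summand j with j ∈? W | j ≟ i
      ... | yes j∈W | no j≢i = cong ⟦_⟧ (uses≡crossing oriented j j∈W j≢i e)
      ... | yes _   | yes _  = refl
      ... | no _    | _      = refl

    yval≡y-loads : ∀ {P b} → Oriented P b → ∀ e → yval W i P e ≡ y (suc K) (loads (decided b) (position e))
    yval≡y-loads oriented e = cong₂ y (sym 1+K≡∣W∣) (load≡loads oriented e)

    path-orientation : ∀ (P : Solution n W i) j (j∈W : j ∈ W) (j≢i : j ≢ i) →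
                       Σ Bool λ b → ∀ e → uses e (proj₁ (P j j∈W j≢i)) ≡ crossing b (position j ≤ᵇ position e)
    path-orientation P j j∈W j≢i with simple-walk-avoids-cut j≢i (proj₁ (P j j∈W j≢i)) (proj₂ (P j j∈W j≢i))
    ... | c , c≤n₀ , avoids with toLineWalk (cutShift c) (proj₁ (P j j∈W j≢i)) avoids
    ...   | l , traced = (position j ≤ᵇ c) , traced-orientation c≤n₀ traced (traces-simple _ traced (proj₂ (P j j∈W j≢i)))

    every-solution-oriented : ∀ P → Σ Orientation (Oriented P)
    every-solution-oriented P = (λ j j∈W j≢i → proj₁ (path-orientation P j j∈W j≢i)) ,
                                record { uses≡crossing = λ j j∈W j≢i → proj₂ (path-orientation P j j∈W j≢i) }

    treeSolution : ℕ → Solution n W i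
    treeSolution c j _ _ = proj₁ (straightWalk (cutShift c) i j) , straightWalk-simple (cutShift c) i j

    treeOrientation : ℕ → Orientation
    treeOrientation c j _ _ = position j ≤ᵇ c

    tree-oriented : ∀ {c} → c ≤ n₀ → Oriented (treeSolution c) (treeOrientation c)
    tree-oriented c≤n₀ = record { uses≡crossing = λ j _ _ → traced-orientation c≤n₀ (proj₂ (straightWalk _ i j)) (straight-simple _ _) }

    loads-cong : ∀ {b b'} → (∀ j → destination j ≡ true → b j ≡ b' j) → ∀ p → loads b p ≡ loads b' p
    loads-cong {b} {b'} b≡b' p = sum-cong (allFin n) same
      where
      same : ∀ j → passes (destination j) (b j) (position j) p ≡ passes (destination j) (b' j) (position j) p
      same j with destination j in d
      ... | true  = cong (λ b → passes true b (position j) p) (b≡b' j d)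
      ... | false = refl

    decided-treeOrientation : ∀ c j → destination j ≡ true → decided (treeOrientation c) j ≡ (position j ≤ᵇ c)
    decided-treeOrientation c j with j ∈? W | j ≟ i
    ... | yes _ | no _  = λ _ → refl
    ... | yes _ | yes _ = λ ()
    ... | no _  | _     = λ ()

    tree-loads : ∀ c p → loads (λ j → position j ≤ᵇ c) p ≡ ∣ arrived p - arrived c ∣
    tree-loads c p with p ≤? c
    ... | yes p≤c = begin
      loads (λ j → position j ≤ᵇ c) p            ≡⟨ sum-cong (allFin n) (λ j → passes-before-cut (destination j) (position j) p≤c) ⟩
      entering p c                               ≡⟨ sym (∣m-m+n∣≡n (arrived p) (entering p c)) ⟩
      ∣ arrived p - arrived p + entering p c ∣   ≡⟨ cong (∣ arrived p -_∣) (sym (arrived-split p≤c)) ⟩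
      ∣ arrived p - arrived c ∣                  ∎
      where open ≡-Reasoning
    ... | no p≰c = begin
      loads (λ j → position j ≤ᵇ c) p            ≡⟨ sum-cong (allFin n) (λ j → passes-after-cut (destination j) (position j) c≤p) ⟩
      entering c p                               ≡⟨ sym (∣m-m+n∣≡n (arrived c) (entering c p)) ⟩
      ∣ arrived c - arrived c + entering c p ∣   ≡⟨ cong (∣ arrived c -_∣) (sym (arrived-split c≤p)) ⟩
      ∣ arrived c - arrived p ∣                  ≡⟨ ∣-∣-comm (arrived c) (arrived p) ⟩
      ∣ arrived p - arrived c ∣                  ∎
      where
      open ≡-Reasoning
      c≤p : c ≤ p
      c≤p = <⇒≤ (≰⇒> p≰c)

    module LoadProfile (b : Fin n → Bool) = Profile K n₀ arrived (loads b) arrived-zero arrived-end arrived-step (consistent b)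

    dominating-tree : ∀ {Q b} → Oriented Q b → ∀ {c} → c ≤ n₀ → LoadProfile.Dominating (decided b) (arrived c) →
                      ∀ e → yval W i (treeSolution c) e ≤ yval W i Q e
    dominating-tree {Q} {b} oriented {c} c≤n₀ dominating e = begin
      yval W i (treeSolution c) e                                    ≡⟨ yval≡y-loads (tree-oriented c≤n₀) e ⟩
      y (suc K) (loads (decided (treeOrientation c)) (position e))   ≡⟨ cong (y (suc K)) tree-load ⟩
      y (suc K) ∣ arrived (position e) - arrived c ∣                 ≤⟨ dominating (position e) (position≤n₀ e) ⟩
      y (suc K) (loads (decided b) (position e))                     ≡⟨ sym (yval≡y-loads oriented e) ⟩
      yval W i Q e                                                   ∎
      where
      open ≤-Reasoning
      tree-load : loads (decided (treeOrientation c)) (position e) ≡ ∣ arrived (position e) - arrived c ∣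
      tree-load = trans (loads-cong (decided-treeOrientation c) (position e)) (tree-loads c (position e))

    TreeDominated : Solution n W i → Set
    TreeDominated Q = Σ ℕ λ c → Σ (c ≤ n₀) λ c≤n₀ → ∀ e → yval W i (treeSolution c) e ≤ yval W i Q e

    -- The implicit arguments are given: inferring b from the type of dominating would unfold loads.
    cut-tree-dominates : ∀ {Q b} → Oriented Q b → LoadProfile.DominatingCut (decided b) → TreeDominated Q
    cut-tree-dominates {Q} {b} oriented (c , c≤n₀ , dominating) = c , c≤n₀ , dominating-tree {Q} {b} oriented {c} c≤n₀ dominating

    tree-dominates : ∀ Q → TreeDominated Q
    tree-dominates Q = cut-tree-dominates (proj₂ (every-solution-oriented Q))
                                          (LoadProfile.dominating-cut (decided (proj₁ (every-solution-oriented Q))))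

    module _ {c} (c≤n₀ : c ≤ n₀) where

      private
        path-traces : ∀ j → Traces (cutShift c) (proj₁ (straightWalk (cutShift c) i j)) (straight (cutCoord c i) (cutCoord c j))
        path-traces j = proj₂ (straightWalk (cutShift c) i j)

      OnTreePath : ℕ → Set
      OnTreePath z = Σ (Fin n) λ j → Σ (j ∈ W) λ j∈W → Σ (j ≢ i) λ j≢i → EdgeBetween z (cutCoord c i) (cutCoord c j)

      InH-edge⇔OnTreePath : ∀ {e} → InH-edge W i (treeSolution c) e ⇔ OnTreePath (cutCoord c e)
      InH-edge⇔OnTreePath = mk⇔
        (λ (j , j∈W , j≢i , e∈path) → j , j∈W , j≢i , Equivalence.to (traced-edges⇔ _ (path-traces j) (straight-simple _ _)) e∈path)
        (λ (j , j∈W , j≢i , between) → j , j∈W , j≢i , Equivalence.from (traced-edges⇔ _ (path-traces j) (straight-simple _ _)) between)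

      H-edge-inner : ∀ {e} → InH-edge W i (treeSolution c) e → cutCoord c e ≢ n₀
      H-edge-inner e∈H e↦n₀ with Equivalence.to InH-edge⇔OnTreePath e∈H
      ... | j , _ , _ , inj₁ (_ , e<j) = <⇒≢ (<-≤-trans e<j (≤-pred (coord<n _ j))) e↦n₀
      ... | j , _ , _ , inj₂ (_ , e<i) = <⇒≢ (<-≤-trans e<i (≤-pred (coord<n _ i))) e↦n₀

      towards-H-vertex : ∀ {u z} → InH-vertex W i (treeSolution c) u → EdgeBetween z (cutCoord c i) (cutCoord c u) → OnTreePath z
      towards-H-vertex (inj₁ refl) between = contradiction between EdgeBetween-irrefl
      towards-H-vertex (inj₂ (j , j∈W , j≢i , u∈path)) between =
        j , j∈W , j≢i , EdgeBetween-extend (traced-vertices⇒ _ (path-traces j) (straight-simple _ _) u∈path) between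

      between-H-vertices : ∀ {u v e} → InH-vertex W i (treeSolution c) u → InH-vertex W i (treeSolution c) v →
                           EdgeBetween (cutCoord c e) (cutCoord c u) (cutCoord c v) → InH-edge W i (treeSolution c) e
      between-H-vertices hu hv between with EdgeBetween-split (cutCoord c i) between
      ... | inj₁ towards-u = Equivalence.from InH-edge⇔OnTreePath (towards-H-vertex hu towards-u)
      ... | inj₂ towards-v = Equivalence.from InH-edge⇔OnTreePath (towards-H-vertex hv towards-v)

      tree-solution : TreeSolution W i (treeSolution c)
      tree-solution u v hu hv = ((walk , straightWalk-simple _ u v) , All.tabulate in-H) , unique
        where
        walk : Walk n u v
        walk = proj₁ (straightWalk (cutShift c) u v)
        in-H : ∀ {e} → e ∈ₗ edges walk → InH-edge W i (treeSolution c) e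
        in-H e∈walk = between-H-vertices hu hv (Equivalence.to (traced-edges⇔ _ (proj₂ (straightWalk _ u v)) (straight-simple _ _)) e∈walk)
        line : (p : SimplePath n u v) → WalkInH W i (treeSolution c) (proj₁ p) → Σ (LineWalk (cutCoord c u) (cutCoord c v)) (Traces (cutShift c) (proj₁ p))
        line p in-H = toLineWalk (cutShift c) (proj₁ p) (All.map H-edge-inner in-H)
        unique : (p q : SimplePath n u v) → WalkInH W i (treeSolution c) (proj₁ p) → WalkInH W i (treeSolution c) (proj₁ q) →
                 verts (proj₁ p) ≡ verts (proj₁ q)
        unique p q hp hq with line p hp | line q hq
        ... | l , traced-p | l' , traced-q = map-injective (coord-injective _) (begin
          map (cutCoord c) (verts (proj₁ p))   ≡⟨ proj₁ traced-p ⟩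
          lineVertices l                       ≡⟨ simple-walks-agree l l' (traces-simple _ traced-p (proj₂ p)) (traces-simple _ traced-q (proj₂ q)) ⟩
          lineVertices l'                      ≡⟨ sym (proj₁ traced-q) ⟩
          map (cutCoord c) (verts (proj₁ q))   ∎)
          where open ≡-Reasoning

open import Defs
open Sums using (sumℚ-mono; ℕtoℚ-mono)
open RingRouting using (module PyramidalRouting)
open import Data.Nat using (ℕ; zero; suc; z≤n; s≤s)
import Data.Nat.Properties as ℕ
open import Data.Fin using (Fin)
open import Data.Fin.Subset using (Subset; _∈_)
open import Data.Rational using (ℚ; 0ℚ; _≤_; nonNegative)
import Data.Rational.Properties as ℚ
open import Data.List using (allFin)
open import Data.Product using (Σ; _×_; _,_)
open import Data.Sum using (inj₁; inj₂)
open import Relation.Binary.PropositionalEquality using (refl)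

cost-mono : ∀ {n} (c : Fin n → ℚ) → (∀ e → 0ℚ ≤ c e) → ∀ {W i} (P Q : Solution n W i) →
            (∀ e → yval W i P e Data.Nat.≤ yval W i Q e) → cost c W i P ≤ cost c W i Q
cost-mono {n} c c≥0 P Q y≤y = sumℚ-mono (allFin n) (λ e → ℚ.*-monoˡ-≤-nonNeg (c e) {{nonNegative (c≥0 e)}} (ℕtoℚ-mono (y≤y e)))

argmin : (g : ℕ → ℚ) (N : ℕ) → Σ ℕ λ m → m Data.Nat.≤ N × (∀ m' → m' Data.Nat.≤ N → g m ≤ g m')
argmin g zero = 0 , z≤n , λ { .zero z≤n → ℚ.≤-refl }
argmin g (suc N) with argmin g N
... | m , m≤N , minimal with ℚ.≤-total (g m) (g (suc N))
...   | inj₁ gm≤gN+1 = m , ℕ.m≤n⇒m≤1+n m≤N , below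
  where
  below : ∀ m' → m' Data.Nat.≤ suc N → g m ≤ g m'
  below m' m'≤N+1 with ℕ.m≤n⇒m<n∨m≡n m'≤N+1
  ... | inj₁ m'<N+1 = minimal m' (ℕ.≤-pred m'<N+1)
  ... | inj₂ refl = gm≤gN+1
...   | inj₂ gN+1≤gm = suc N , ℕ.≤-refl , below
  where
  below : ∀ m' → m' Data.Nat.≤ suc N → g (suc N) ≤ g m'
  below m' m'≤N+1 with ℕ.m≤n⇒m<n∨m≡n m'≤N+1
  ... | inj₁ m'<N+1 = ℚ.≤-trans gN+1≤gm (minimal m' (ℕ.≤-pred m'<N+1))
  ... | inj₂ refl = ℚ.≤-refl

theorem2 : (n : ℕ) → 3 Data.Nat.≤ n → (c : Fin n → ℚ) → ((e : Fin n) → 0ℚ Data.Rational.≤ c e) →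
    (W : Subset n) → (i : Fin n) → i ∈ W →
    Σ (Solution n W i) (λ P → Optimal c W i P × TreeSolution W i P)
theorem2 .(suc n₀) (s≤s {n = n₀} (s≤s (s≤s z≤n))) c c≥0 W i i∈W = cheapest (argmin (λ t → cost c W i (treeSolution t)) n₀)
  where
  open PyramidalRouting n₀ i W i∈W
  cheapest : (Σ ℕ λ t → t Data.Nat.≤ n₀ × (∀ t' → t' Data.Nat.≤ n₀ → cost c W i (treeSolution t) ≤ cost c W i (treeSolution t'))) →
             Σ (Solution (suc n₀) W i) (λ P → Optimal c W i P × TreeSolution W i P)
  cheapest (t , t≤n₀ , minimal) = treeSolution t , optimal , tree-solution t≤n₀
    where
    beats : ∀ Q → TreeDominated Q → cost c W i (treeSolution t) ≤ cost c W i Q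
    beats Q (t' , t'≤n₀ , dominated) = ℚ.≤-trans (minimal t' t'≤n₀) (cost-mono c c≥0 (treeSolution t') Q dominated)
    optimal : Optimal c W i (treeSolution t)
    optimal Q = beats Q (tree-dominates Q)
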